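{- Let $\psi(\alpha;q)=\sum_{n=1}^\infty \frac{q^{n^2}}{(\alpha;q^2)_n}$, and let $P_{do}$ denote the set of partitions into distinct parts with the smallest part being odd. Then \[ (-\alpha;q)_\infty\,\psi(-\alpha q;-q)=-\sum_{\nu \in P_{do}}\alpha^{l(\nu)}q^{|\nu|}+\sum_{k=1}^\infty (-1)^k q^{k^2}. \]
   Context: Notation: $(a;q)_n=(1-a)(1-aq)\cdots(1-aq^{n-1})$, $(a;q)_\infty=\prod_{n\ge0}(1-aq^n)$; identities of formal power series in $q$. For a partition $\nu$, $|\nu|$ is the sum of its parts and $l(\nu)$ its number of parts. -}

module Defs where

open import Data.Bool using (Bool; true; false; if_then_else_)
open import Data.Nat as ℕ using (ℕ; zero; suc; _≡ᵇ_; _≤ᵇ_; _∸_; _≤_; _>_)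
open import Data.Integer using (ℤ; +_; -_; _+_; _*_; -1ℤ; _^_)
open import Data.List using (List)
open import Data.List.Membership.Propositional using (_∈_)
open import Data.List.Relation.Unary.All using (All)
open import Data.List.Relation.Unary.Linked using (Linked)
open import Data.Product using (Σ; _×_; ∃)
open import Relation.Binary.PropositionalEquality using (_≡_)

-- Formal power series in two variables α, q over ℤ:  ℤ[[α,q]].
-- (f n j) is the coefficient of  q^n α^j.

PS : Set
PS = ℕ → ℕ → ℤ

Σ≤ : ℕ → (ℕ → ℤ) → ℤ
Σ≤ zero    f = f 0
Σ≤ (suc n) f = Σ≤ n f + f (suc n)

δ : ℕ → ℕ → ℤ
δ a b = if a ≡ᵇ b then + 1 else + 0

0ₚ : PS
0ₚ n j = + 0

1ₚ : PS
1ₚ n j = δ n 0 * δ j 0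

mono : ℤ → ℕ → ℕ → PS
mono c a b n j = c * (δ n a * δ j b)

_+ₚ_ : PS → PS → PS
(f +ₚ g) n j = f n j + g n j

_*ₚ_ : PS → PS → PS
(f *ₚ g) n j = Σ≤ n (λ a → Σ≤ j (λ b → f a b * g (n ∸ a) (j ∸ b)))

sumFrom : ℕ → ℕ → (ℕ → PS) → PS
sumFrom a zero    F = if a ≤ᵇ 0 then F 0 else 0ₚ
sumFrom a (suc b) F = if a ≤ᵇ suc b then sumFrom a b F +ₚ F (suc b) else 0ₚ

prodBelow : ℕ → (ℕ → PS) → PS
prodBelow zero    F = 1ₚ
prodBelow (suc k) F = prodBelow k F *ₚ F k

onePlusαq^ : ℕ → PS
onePlusαq^ m = 1ₚ +ₚ mono (+ 1) m 1

-- 1 / (1 - α q^m) = Σ_{k≥0} α^k q^{m k}  (inverse in ℤ[[α,q]])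
invOneMinusαq^ : ℕ → PS
invOneMinusαq^ m n j = δ n (m ℕ.* j)

-- The coefficient of q^N of a q-adically
-- convergent sum/product only involves finitely many terms/factors; we
-- define the coefficient of q^N via the corresponding finite truncation.

-- ψ(α;q) = Σ_{n≥1} q^{n²} / (α;q²)_n ,  (α;q²)_n = Π_{i<n} (1 - α q^{2i}).
-- Terms with n > N have q-order n² > N.
ψ : PS
ψ N j = sumFrom 1 N (λ n → mono (+ 1) (n ℕ.* n) 0 *ₚ prodBelow n (λ i → invOneMinusαq^ (2 ℕ.* i))) N j

-- (-α;q)_∞ = Π_{i≥0} (1 + α q^i).  Factors with i > N are ≡ 1 mod q^{N+1}.
negαPoch∞ : PS
negαPoch∞ N j = prodBelow (suc N) onePlusαq^ N j

-- Substitution  α ↦ -α q ,  q ↦ -q :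
--   α^j q^N ↦ (-1)^{j+N} α^j q^{j+N}.
substNegαq : PS → PS
substNegαq f M j = if j ≤ᵇ M then (-1ℤ ^ M) * f (M ∸ j) j else + 0

-- Σ_{k≥1} (-1)^k q^{k²}   (terms with k > N have q-order > N)
sqSeries : PS
sqSeries N j = sumFrom 1 N (λ k → mono (-1ℤ ^ k) (k ℕ.* k) 0) N j

-- Partitions into distinct parts with smallest part odd.
-- A partition into distinct parts is a strictly decreasing list of
-- positive integers.

Odd : ℕ → Set
Odd x = ∃ λ k → x ≡ suc (2 ℕ.* k)

IsPdo : List ℕ → Set
IsPdo ν = Linked _>_ ν
        × All (λ x → x > 0) ν
        × Σ ℕ (λ s → s ∈ ν × Odd s × All (s ≤_) ν)

-- Let F(α) = (-α;q)_∞ ψ(-αq;-q) = Σ_{n≥1} (-1)^n q^{n²} (-α;q)_∞ / (-αq;q²)_n and let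
-- D(α) = Σ_{ν ∈ P_do} α^{l(ν)} q^{|ν|}. Since (1 + αq^{2n+1}) / (-αq;q²)_{n+1} = 1 / (-αq;q²)_n,
-- the terms of F telescope against those of (1 + α) F(αq²), giving F(αq²) = F(α) + αq (-αq²;q)_∞
-- once the unit 1 + α is cancelled. Splitting P_do according to whether the smallest part is 1
-- (the other parts being arbitrary distinct parts ≥ 2) or not (then subtract 2 from every part)
-- gives D(α) = D(αq²) + αq (-αq²;q)_∞. Hence W = F + D satisfies W(α) = W(αq²), which forces the
-- coefficient of α^j q^n to vanish for j ≥ 1, so W = W(0) = Σ_{k≥1} (-1)^k q^{k²}.
-- All of this is done modulo q^(N+1), where the infinite sums and products are finite.

module Submission where

open import Defs
open import Algebra.Bundles using (CommutativeRing; Semiring)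
open import Algebra.Bundles.Raw using (RawSemiring)
open import Algebra.Core using (Op₂)
open import Algebra.Definitions using (Congruent₁; Congruent₂)
import Algebra.Morphism.Construct.Composition as Compose
open import Algebra.Morphism.Structures using (IsSemiringHomomorphism)
open import Algebra.Structures using (IsCommutativeRing)
open import Data.Bool using (true; false; if_then_else_)
open import Data.Empty using (⊥-elim)
open import Data.Nat as ℕ using (ℕ; zero; suc; _∸_; _≤_; _<_; _>_; z≤n; s≤s; _≤ᵇ_; _≡ᵇ_)
open import Data.List using (List; []; _∷_; [_]; _++_; map; length)
open import Data.List.Membership.Propositional using (_∈_)
open import Data.List.Membership.Propositional.Properties using (∈-++⁻; ∈-++⁺ˡ; ∈-++⁺ʳ; ∈-map⁻; ∈-map⁺)
import Data.List.Properties as Listₚ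
open import Data.List.Relation.Unary.All as All using (All; []; _∷_)
open import Data.List.Relation.Unary.AllPairs using ([]; _∷_)
open import Data.List.Relation.Unary.Any using (here; there)
open import Data.List.Relation.Unary.Linked using (Linked; [-]; _∷_)
open import Data.List.Relation.Unary.Unique.Propositional using (Unique)
import Data.List.Relation.Unary.Unique.Propositional.Properties as Uniqueₚ
open import Data.Nat.Induction using (<-rec)
open import Data.Nat.ListAction using (sum)
import Data.Nat.Properties as ℕₚ
import Data.Nat.Tactic.RingSolver as ℕ-Solver
open import Data.Product using (∃; Σ-syntax; _×_; _,_; proj₁)
open import Data.Sum using (inj₁; inj₂)
open import Function using (_∘_)
open import Function.Bundles using (_⇔_; mk⇔)
open import Relation.Binary.Core using (Rel; _⇒_)
open import Relation.Binary.PropositionalEquality as ≡ using (_≡_; _≢_; cong; cong₂)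
open import Relation.Binary.Structures using (IsEquivalence)
open import Relation.Nullary using (¬_; Dec; yes; no; map′)
open import Relation.Nullary.Reflects using (Reflects; ofʸ; ofⁿ; fromEquivalence)

≡ᵇ-reflects-≡ : ∀ m n → Reflects (m ≡ n) (m ≡ᵇ n)
≡ᵇ-reflects-≡ m n = fromEquivalence (ℕₚ.≡ᵇ⇒≡ m n) (ℕₚ.≡⇒≡ᵇ m n)

module _ {c ℓ} (R : CommutativeRing c ℓ) where

  open CommutativeRing R
  open import Relation.Binary.Reasoning.Setoid setoid
  open import Algebra.Solver.Ring.NaturalCoefficients.Default commutativeSemiring

  isCommutativeRing-replace-*-1# : ∀ {_*′_ : Op₂ Carrier} {1#′} →
    (∀ x y → (x *′ y) ≈ (x * y)) → 1#′ ≈ 1# → IsCommutativeRing _≈_ _+_ _*′_ (-_) 0# 1#′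
  isCommutativeRing-replace-*-1# {_*′_} {1#′} *′≈* 1#′≈1# = record
    { isRing = record
      { +-isAbelianGroup = +-isAbelianGroup
      ; *-cong = λ {x} {y} {u} {v} x≈y u≈v → begin
          (x *′ u) ≈⟨ *′≈* x u ⟩ x * u ≈⟨ *-cong x≈y u≈v ⟩ y * v ≈⟨ *′≈* y v ⟨ (y *′ v) ∎
      ; *-assoc = λ x y z → begin
          ((x *′ y) *′ z) ≈⟨ *′≈* _ z ⟩
          (x *′ y) * z  ≈⟨ *-congʳ (*′≈* x y) ⟩
          (x * y) * z   ≈⟨ *-assoc x y z ⟩
          x * (y * z)   ≈⟨ *-congˡ (*′≈* y z) ⟨
          x * (y *′ z)  ≈⟨ *′≈* x _ ⟨
          (x *′ (y *′ z)) ∎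
      ; *-identity = (λ x → begin
            (1#′ *′ x) ≈⟨ *′≈* 1#′ x ⟩ 1#′ * x ≈⟨ *-congʳ 1#′≈1# ⟩ 1# * x ≈⟨ *-identityˡ x ⟩ x ∎)
                   , (λ x → begin
            (x *′ 1#′) ≈⟨ *′≈* x 1#′ ⟩ x * 1#′ ≈⟨ *-congˡ 1#′≈1# ⟩ x * 1# ≈⟨ *-identityʳ x ⟩ x ∎)
      ; distrib = (λ x y z → begin
            (x *′ (y + z))       ≈⟨ *′≈* x _ ⟩
            x * (y + z)        ≈⟨ distribˡ x y z ⟩
            x * y + x * z      ≈⟨ +-cong (*′≈* x y) (*′≈* x z) ⟨
            (x *′ y) + (x *′ z)    ∎)
                , (λ x y z → begin
            ((y + z) *′ x)       ≈⟨ *′≈* _ x ⟩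
            (y + z) * x        ≈⟨ distribʳ x y z ⟩
            y * x + z * x      ≈⟨ +-cong (*′≈* y x) (*′≈* z x) ⟨
            (y *′ x) + (z *′ x)    ∎)
      }
    ; *-comm = λ x y → begin
        (x *′ y) ≈⟨ *′≈* x y ⟩ x * y ≈⟨ *-comm x y ⟩ y * x ≈⟨ *′≈* y x ⟨ (y *′ x) ∎
    }

  isCommutativeRing-coarsen : ∀ {ℓ′} {_≈′_ : Rel Carrier ℓ′} → IsEquivalence _≈′_ → _≈_ ⇒ _≈′_ →
    Congruent₂ _≈′_ _+_ → Congruent₁ _≈′_ (-_) → Congruent₂ _≈′_ _*_ →
    IsCommutativeRing _≈′_ _+_ _*_ (-_) 0# 1#
  isCommutativeRing-coarsen isEq ≈⇒≈′ +-cong′ -‿cong′ *-cong′ = record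
    { isRing = record
      { +-isAbelianGroup = record
        { isGroup = record
          { isMonoid = record
            { isSemigroup = record
              { isMagma = record { isEquivalence = isEq ; ∙-cong = +-cong′ }
              ; assoc = λ x y z → ≈⇒≈′ (+-assoc x y z) }
            ; identity = (λ x → ≈⇒≈′ (+-identityˡ x)) , (λ x → ≈⇒≈′ (+-identityʳ x)) }
          ; inverse = (λ x → ≈⇒≈′ (-‿inverseˡ x)) , (λ x → ≈⇒≈′ (-‿inverseʳ x))
          ; ⁻¹-cong = -‿cong′ }
        ; comm = λ x y → ≈⇒≈′ (+-comm x y) }
      ; *-cong = *-cong′
      ; *-assoc = λ x y z → ≈⇒≈′ (*-assoc x y z)
      ; *-identity = (λ x → ≈⇒≈′ (*-identityˡ x)) , (λ x → ≈⇒≈′ (*-identityʳ x))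
      ; distrib = (λ x y z → ≈⇒≈′ (distribˡ x y z)) , (λ x y z → ≈⇒≈′ (distribʳ x y z)) }
    ; *-comm = λ x y → ≈⇒≈′ (*-comm x y) }

  *-cancelˡ-invertible : ∀ {u v x y} → u * v ≈ 1# → u * x ≈ u * y → x ≈ y
  *-cancelˡ-invertible {u} {v} {x} {y} uv≈1 ux≈uy = begin
    x             ≈⟨ *-identityˡ x ⟨
    1# * x        ≈⟨ *-congʳ (trans (*-comm v u) uv≈1) ⟨
    (v * u) * x   ≈⟨ *-assoc v u x ⟩
    v * (u * x)   ≈⟨ *-congˡ ux≈uy ⟩
    v * (u * y)   ≈⟨ *-assoc v u y ⟨
    (v * u) * y   ≈⟨ *-congʳ (trans (*-comm v u) uv≈1) ⟩
    1# * y        ≈⟨ *-identityˡ y ⟩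
    y             ∎

  -- The algebra behind F(αq²) = F(α) + αq (-αq²;q)_∞, with a = α and s = F(αq²).
  telescoping-identity : ∀ {a i G U V Y s p q} → (1# + a) * i ≈ 1# →
    G ≈ U + - (a * V) → (1# + a) * s ≈ U → G ≈ Y + V → a * Y ≈ - (q * ((1# + a) * p)) →
    s ≈ G + q * p
  telescoping-identity {a} {i} {G} {U} {V} {Y} {s} {p} {q} unit G≈U-aV s-shift G≈Y+V aY≈ =
    *-cancelˡ-invertible unit (begin
      (1# + a) * s                             ≈⟨ s-shift ⟩
      U                                        ≈⟨ +-identityʳ U ⟨
      U + 0#                                   ≈⟨ +-congˡ (-‿inverseˡ (a * V)) ⟨
      U + (- (a * V) + a * V)                  ≈⟨ +-assoc U (- (a * V)) (a * V) ⟨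
      (U + - (a * V)) + a * V                  ≈⟨ +-congʳ G≈U-aV ⟨
      G + a * V                                ≈⟨ +-identityʳ (G + a * V) ⟨
      (G + a * V) + 0#                         ≈⟨ +-congˡ (-‿inverseˡ X) ⟨
      (G + a * V) + (- X + X)                  ≈⟨ +-congˡ (+-congʳ aY≈) ⟨
      (G + a * V) + (a * Y + X)                ≈⟨ regroup G a Y V q p ⟩
      G + (a * (Y + V) + X)                    ≈⟨ +-congˡ (+-congʳ (*-congˡ G≈Y+V)) ⟨
      G + (a * G + X)                          ≈⟨ expand G a q p ⟨
      (1# + a) * (G + q * p)                   ∎)
    where
    X : Carrier
    X = q * ((1# + a) * p)
    regroup : ∀ G a Y V q p → (G + a * V) + (a * Y + q * ((1# + a) * p)) ≈ G + (a * (Y + V) + q * ((1# + a) * p))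
    regroup = solve 6 (λ G a Y V q p → (G :+ a :* V) :+ (a :* Y :+ q :* ((con 1 :+ a) :* p))
                                     := G :+ (a :* (Y :+ V) :+ q :* ((con 1 :+ a) :* p))) refl
    expand : ∀ G a q p → (1# + a) * (G + q * p) ≈ G + (a * G + q * ((1# + a) * p))
    expand = solve 4 (λ G a q p → (con 1 :+ a) :* (G :+ q :* p) := G :+ (a :* G :+ q :* ((con 1 :+ a) :* p))) refl

module FiniteSum {c ℓ} (R : CommutativeRing c ℓ) where

  open CommutativeRing R hiding (zero)
  open import Relation.Binary.Reasoning.Setoid setoid
  open import Algebra.Properties.CommutativeSemigroup +-commutativeSemigroup using (interchange)

  sumUpTo : ℕ → (ℕ → Carrier) → Carrier
  sumUpTo zero    f = f 0
  sumUpTo (suc n) f = sumUpTo n f + f (suc n)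

  sumUpTo-cong : ∀ n {f g} → (∀ i → i ≤ n → f i ≈ g i) → sumUpTo n f ≈ sumUpTo n g
  sumUpTo-cong zero    f≈g = f≈g 0 z≤n
  sumUpTo-cong (suc n) f≈g =
    +-cong (sumUpTo-cong n (λ i i≤n → f≈g i (ℕₚ.m≤n⇒m≤1+n i≤n))) (f≈g (suc n) ℕₚ.≤-refl)

  sumUpTo-zero : ∀ n f → (∀ i → i ≤ n → f i ≈ 0#) → sumUpTo n f ≈ 0#
  sumUpTo-zero zero    f f≈0 = f≈0 0 z≤n
  sumUpTo-zero (suc n) f f≈0 =
    trans (+-cong (sumUpTo-zero n f (λ i i≤n → f≈0 i (ℕₚ.m≤n⇒m≤1+n i≤n))) (f≈0 (suc n) ℕₚ.≤-refl))
          (+-identityˡ 0#)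

  sumUpTo-single : ∀ n k f → k ≤ n → (∀ i → i ≤ n → i ≢ k → f i ≈ 0#) → sumUpTo n f ≈ f k
  sumUpTo-single zero    .zero f z≤n _ = refl
  sumUpTo-single (suc n) k     f k≤1+n others with k ℕ.≟ suc n
  ... | yes ≡.refl = trans (+-congʳ (sumUpTo-zero n f (λ i i≤n →
                             others i (ℕₚ.m≤n⇒m≤1+n i≤n) (ℕₚ.<⇒≢ (s≤s i≤n)))))
                           (+-identityˡ _)
  ... | no k≢1+n = trans (+-congˡ (others (suc n) ℕₚ.≤-refl (k≢1+n ∘ ≡.sym)))
                  (trans (+-identityʳ _)
                  (sumUpTo-single n k f (ℕₚ.m<1+n⇒m≤n (ℕₚ.≤∧≢⇒< k≤1+n k≢1+n))
                                        (λ i i≤n → others i (ℕₚ.m≤n⇒m≤1+n i≤n))))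

  sumUpTo-+ : ∀ n f g → sumUpTo n (λ i → f i + g i) ≈ sumUpTo n f + sumUpTo n g
  sumUpTo-+ zero    f g = refl
  sumUpTo-+ (suc n) f g = trans (+-congʳ (sumUpTo-+ n f g)) (interchange _ _ _ _)

  sumUpTo-*ˡ : ∀ n x f → x * sumUpTo n f ≈ sumUpTo n (λ i → x * f i)
  sumUpTo-*ˡ zero    x f = refl
  sumUpTo-*ˡ (suc n) x f = trans (distribˡ x _ _) (+-congʳ (sumUpTo-*ˡ n x f))

  sumUpTo-*ʳ : ∀ n x f → sumUpTo n f * x ≈ sumUpTo n (λ i → f i * x)
  sumUpTo-*ʳ zero    x f = refl
  sumUpTo-*ʳ (suc n) x f = trans (distribʳ x _ _) (+-congʳ (sumUpTo-*ʳ n x f))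

  sumUpTo-suc : ∀ n f → sumUpTo (suc n) f ≈ f 0 + sumUpTo n (λ i → f (suc i))
  sumUpTo-suc zero    f = refl
  sumUpTo-suc (suc n) f = trans (+-congʳ (sumUpTo-suc n f)) (+-assoc _ _ _)

  sumUpTo-reverse : ∀ n f → sumUpTo n f ≈ sumUpTo n (λ i → f (n ∸ i))
  sumUpTo-reverse zero    f = refl
  sumUpTo-reverse (suc n) f = begin
    sumUpTo n f + f (suc n)                              ≈⟨ +-congʳ (sumUpTo-reverse n f) ⟩
    sumUpTo n (λ i → f (n ∸ i)) + f (suc n)              ≈⟨ +-comm _ _ ⟩
    f (suc n) + sumUpTo n (λ i → f (suc n ∸ suc i))      ≈⟨ sumUpTo-suc n (λ i → f (suc n ∸ i)) ⟨
    sumUpTo (suc n) (λ i → f (suc n ∸ i))                ∎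

  sumUpTo-swap : ∀ m n (F : ℕ → ℕ → Carrier) →
    sumUpTo m (λ i → sumUpTo n (F i)) ≈ sumUpTo n (λ j → sumUpTo m (λ i → F i j))
  sumUpTo-swap zero    n F = refl
  sumUpTo-swap (suc m) n F =
    trans (+-congʳ (sumUpTo-swap m n F)) (sym (sumUpTo-+ n (λ j → sumUpTo m (λ i → F i j)) (F (suc m))))

  sumUpTo-triangle : ∀ n (F : ℕ → ℕ → Carrier) →
    sumUpTo n (λ a → sumUpTo a (λ b → F b a)) ≈ sumUpTo n (λ b → sumUpTo (n ∸ b) (λ d → F b (b ℕ.+ d)))
  sumUpTo-triangle zero    F = refl
  sumUpTo-triangle (suc n) F = begin
    sumUpTo n (λ a → sumUpTo a (λ b → F b a)) + (sumUpTo n (λ b → F b (suc n)) + F (suc n) (suc n))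
      ≈⟨ +-congʳ (sumUpTo-triangle n F) ⟩
    inner n + (sumUpTo n (λ b → F b (suc n)) + F (suc n) (suc n))
      ≈⟨ +-assoc _ _ _ ⟨
    (inner n + sumUpTo n (λ b → F b (suc n))) + F (suc n) (suc n)
      ≈⟨ +-congʳ (sumUpTo-+ n _ _) ⟨
    sumUpTo n (λ b → sumUpTo (n ∸ b) (λ d → F b (b ℕ.+ d)) + F b (suc n)) + F (suc n) (suc n)
      ≈⟨ +-cong (sumUpTo-cong n extend) (reflexive (≡.cong (F (suc n)) (ℕₚ.+-identityʳ (suc n)))) ⟨
    sumUpTo n (λ b → sumUpTo (suc n ∸ b) (λ d → F b (b ℕ.+ d))) + F (suc n) (suc n ℕ.+ 0)
      ≈⟨ +-congˡ (reflexive (≡.cong (λ k → sumUpTo k (λ d → F (suc n) (suc n ℕ.+ d)))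
                                      (ℕₚ.n∸n≡0 (suc n)))) ⟨
    sumUpTo (suc n) (λ b → sumUpTo (suc n ∸ b) (λ d → F b (b ℕ.+ d))) ∎
    where
    inner : ℕ → Carrier
    inner n = sumUpTo n (λ b → sumUpTo (n ∸ b) (λ d → F b (b ℕ.+ d)))
    extend : ∀ b → b ≤ n →
      sumUpTo (suc n ∸ b) (λ d → F b (b ℕ.+ d)) ≈ sumUpTo (n ∸ b) (λ d → F b (b ℕ.+ d)) + F b (suc n)
    extend b b≤n rewrite ℕₚ.+-∸-assoc 1 b≤n =
      +-congˡ (reflexive (≡.cong (F b) (≡.trans (ℕₚ.+-suc b (n ∸ b)) (≡.cong suc (ℕₚ.m+[n∸m]≡n b≤n)))))

module PowerSeries {c ℓ} (R : CommutativeRing c ℓ) where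

  open CommutativeRing R hiding (zero; isCommutativeRing)
  open FiniteSum R

  Series : Set c
  Series = ℕ → Carrier

  infix  4 _≋_ _≋⟨_⟩_
  infixl 6 _⊕_
  infixl 7 _⊛_

  _≋_ : Series → Series → Set ℓ
  f ≋ g = ∀ n → f n ≈ g n

  _≋⟨_⟩_ : Series → ℕ → Series → Set ℓ
  f ≋⟨ N ⟩ g = ∀ n → n ≤ N → f n ≈ g n

  _⊕_ : Series → Series → Series
  (f ⊕ g) n = f n + g n

  ⊝_ : Series → Series
  (⊝ f) n = - f n

  𝟘 : Series
  𝟘 n = 0#

  𝟙 : Series
  𝟙 zero    = 1#
  𝟙 (suc n) = 0#

  _⊛_ : Series → Series → Series
  (f ⊛ g) n = sumUpTo n (λ a → f a * g (n ∸ a))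

  ⊛-cong≤ : ∀ N {f f′ g g′} → f ≋⟨ N ⟩ f′ → g ≋⟨ N ⟩ g′ → f ⊛ g ≋⟨ N ⟩ f′ ⊛ g′
  ⊛-cong≤ N f≋f′ g≋g′ n n≤N = sumUpTo-cong n (λ a a≤n →
    *-cong (f≋f′ a (ℕₚ.≤-trans a≤n n≤N)) (g≋g′ (n ∸ a) (ℕₚ.≤-trans (ℕₚ.m∸n≤m n a) n≤N)))

  ⊛-cong : ∀ {f f′ g g′} → f ≋ f′ → g ≋ g′ → f ⊛ g ≋ f′ ⊛ g′
  ⊛-cong f≋f′ g≋g′ n = sumUpTo-cong n (λ a _ → *-cong (f≋f′ a) (g≋g′ (n ∸ a)))

  ⊛-comm : ∀ f g → f ⊛ g ≋ g ⊛ f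
  ⊛-comm f g n = trans (sumUpTo-reverse n _) (sumUpTo-cong n (λ a a≤n →
    trans (*-congˡ (reflexive (≡.cong g (ℕₚ.m∸[m∸n]≡n a≤n)))) (*-comm _ _)))

  ⊛-assoc : ∀ f g h → (f ⊛ g) ⊛ h ≋ f ⊛ (g ⊛ h)
  ⊛-assoc f g h n = begin
    sumUpTo n (λ a → sumUpTo a (λ b → f b * g (a ∸ b)) * h (n ∸ a))
      ≈⟨ sumUpTo-cong n (λ a _ → sumUpTo-*ʳ a _ _) ⟩
    sumUpTo n (λ a → sumUpTo a (λ b → (f b * g (a ∸ b)) * h (n ∸ a)))
      ≈⟨ sumUpTo-triangle n (λ b a → (f b * g (a ∸ b)) * h (n ∸ a)) ⟩
    sumUpTo n (λ b → sumUpTo (n ∸ b) (λ d → (f b * g (b ℕ.+ d ∸ b)) * h (n ∸ (b ℕ.+ d))))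
      ≈⟨ sumUpTo-cong n (λ b _ → sumUpTo-cong (n ∸ b) (λ d _ → trans (*-assoc _ _ _) (*-congˡ
           (*-cong (reflexive (≡.cong g (ℕₚ.m+n∸m≡n b d)))
                   (reflexive (≡.cong h (≡.sym (ℕₚ.∸-+-assoc n b d)))))))) ⟩
    sumUpTo n (λ b → sumUpTo (n ∸ b) (λ d → f b * (g d * h (n ∸ b ∸ d))))
      ≈⟨ sumUpTo-cong n (λ b _ → sumUpTo-*ˡ (n ∸ b) (f b) _) ⟨
    (f ⊛ (g ⊛ h)) n ∎
    where open import Relation.Binary.Reasoning.Setoid setoid

  ⊛-distribˡ : ∀ f g h → f ⊛ (g ⊕ h) ≋ f ⊛ g ⊕ f ⊛ h
  ⊛-distribˡ f g h n = trans (sumUpTo-cong n (λ a _ → distribˡ _ _ _)) (sumUpTo-+ n _ _)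

  ⊛-distribʳ : ∀ f g h → (g ⊕ h) ⊛ f ≋ g ⊛ f ⊕ h ⊛ f
  ⊛-distribʳ f g h n = trans (sumUpTo-cong n (λ a _ → distribʳ _ _ _)) (sumUpTo-+ n _ _)

  ⊛-identityˡ : ∀ f → 𝟙 ⊛ f ≋ f
  ⊛-identityˡ f n = trans (sumUpTo-single n 0 _ z≤n others) (*-identityˡ (f n))
    where
    others : ∀ i → i ≤ n → i ≢ 0 → 𝟙 i * f (n ∸ i) ≈ 0#
    others zero    _ i≢0 = ⊥-elim (i≢0 ≡.refl)
    others (suc i) _ _   = zeroˡ _

  ⊛-identityʳ : ∀ f → f ⊛ 𝟙 ≋ f
  ⊛-identityʳ f n = trans (⊛-comm f 𝟙 n) (⊛-identityˡ f n)

  isCommutativeRing : IsCommutativeRing _≋_ _⊕_ _⊛_ ⊝_ 𝟘 𝟙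
  isCommutativeRing = record
    { isRing = record
      { +-isAbelianGroup = record
        { isGroup = record
          { isMonoid = record
            { isSemigroup = record
              { isMagma = record
                { isEquivalence = record
                  { refl = λ n → refl ; sym = λ p n → sym (p n) ; trans = λ p q n → trans (p n) (q n) }
                ; ∙-cong = λ p q n → +-cong (p n) (q n) }
              ; assoc = λ f g h n → +-assoc (f n) (g n) (h n) }
            ; identity = (λ f n → +-identityˡ (f n)) , (λ f n → +-identityʳ (f n)) }
          ; inverse = (λ f n → -‿inverseˡ (f n)) , (λ f n → -‿inverseʳ (f n))
          ; ⁻¹-cong = λ p n → -‿cong (p n) }
        ; comm = λ f g n → +-comm (f n) (g n) }
      ; *-cong = ⊛-cong
      ; *-assoc = ⊛-assoc
      ; *-identity = ⊛-identityˡ , ⊛-identityʳ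
      ; distrib = ⊛-distribˡ , ⊛-distribʳ }
    ; *-comm = ⊛-comm }

  seriesRing : CommutativeRing c ℓ
  seriesRing = record { isCommutativeRing = isCommutativeRing }

  monomial : Carrier → ℕ → Series
  monomial x k n = if n ≡ᵇ k then x else 0#

  shift : Carrier → ℕ → Series → Series
  shift x s u n = if s ≤ᵇ n then x * u (n ∸ s) else 0#

  monomial-same : ∀ x k → monomial x k k ≡ x
  monomial-same x k with k ≡ᵇ k | ≡ᵇ-reflects-≡ k k
  ... | true  | _        = ≡.refl
  ... | false | ofⁿ k≢k = ⊥-elim (k≢k ≡.refl)

  monomial-other : ∀ x {k n} → n ≢ k → monomial x k n ≡ 0#
  monomial-other x {k} {n} n≢k with n ≡ᵇ k | ≡ᵇ-reflects-≡ n k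
  ... | true  | ofʸ n≡k = ⊥-elim (n≢k n≡k)
  ... | false | _       = ≡.refl

  monomial-cong : ∀ {x y} k → x ≈ y → monomial x k ≋ monomial y k
  monomial-cong k x≈y n with n ≡ᵇ k
  ... | true  = x≈y
  ... | false = refl

  monomial-⊛ : ∀ x s u → monomial x s ⊛ u ≋ shift x s u
  monomial-⊛ x s u n with s ≤ᵇ n | ℕₚ.≤ᵇ-reflects-≤ s n
  ... | true  | ofʸ s≤n = trans (sumUpTo-single n s _ s≤n others) (*-congʳ (reflexive (monomial-same x s)))
    where
    others : ∀ i → i ≤ n → i ≢ s → monomial x s i * u (n ∸ i) ≈ 0#
    others i _ i≢s = trans (*-congʳ (reflexive (monomial-other x i≢s))) (zeroˡ _)
  ... | false | ofⁿ s≰n = sumUpTo-zero n _ below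
    where
    below : ∀ i → i ≤ n → monomial x s i * u (n ∸ i) ≈ 0#
    below i i≤n = trans (*-congʳ (reflexive (monomial-other x {s} {i} λ { ≡.refl → s≰n i≤n }))) (zeroˡ _)

  monomial-⊛-monomial : ∀ x y s t → monomial x s ⊛ monomial y t ≋ monomial (x * y) (s ℕ.+ t)
  monomial-⊛-monomial x y s t n = trans (monomial-⊛ x s (monomial y t) n) shifted
    where
    shifted : shift x s (monomial y t) n ≈ monomial (x * y) (s ℕ.+ t) n
    shifted with s ≤ᵇ n | ℕₚ.≤ᵇ-reflects-≤ s n
    ... | false | ofⁿ s≰n =
      sym (reflexive (monomial-other (x * y) {s ℕ.+ t} {n} λ { ≡.refl → s≰n (ℕₚ.m≤m+n s t) }))
    ... | true  | ofʸ s≤n with n ∸ s ℕ.≟ t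
    ...   | yes ≡.refl rewrite ℕₚ.m+[n∸m]≡n s≤n =
      reflexive (≡.trans (≡.cong (x *_) (monomial-same y (n ∸ s))) (≡.sym (monomial-same (x * y) n)))
    ...   | no n∸s≢t = trans (*-congˡ (reflexive (monomial-other y n∸s≢t)))
      (trans (zeroʳ x)
      (sym (reflexive (monomial-other (x * y) {s ℕ.+ t} {n} λ { ≡.refl → n∸s≢t (ℕₚ.m+n∸m≡n s t) }))))

  shift-⊛-shift : ∀ x y s t u v → shift x s u ⊛ shift y t v ≋ shift (x * y) (s ℕ.+ t) (u ⊛ v)
  shift-⊛-shift x y s t u v = begin
    shift x s u ⊛ shift y t v                       ≈⟨ S.*-cong (monomial-⊛ x s u) (monomial-⊛ y t v) ⟨
    (monomial x s ⊛ u) ⊛ (monomial y t ⊛ v)         ≈⟨ interchange (monomial x s) u (monomial y t) v ⟩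
    (monomial x s ⊛ monomial y t) ⊛ (u ⊛ v)         ≈⟨ S.*-congʳ {u ⊛ v} (monomial-⊛-monomial x y s t) ⟩
    monomial (x * y) (s ℕ.+ t) ⊛ (u ⊛ v)            ≈⟨ monomial-⊛ (x * y) (s ℕ.+ t) (u ⊛ v) ⟩
    shift (x * y) (s ℕ.+ t) (u ⊛ v)                 ∎
    where
    module S = CommutativeRing seriesRing
    open import Relation.Binary.Reasoning.Setoid S.setoid
    open import Algebra.Properties.CommutativeSemigroup S.*-commutativeSemigroup using (interchange)

  sumUpTo-shift : ∀ x s k (F : ℕ → Series) n →
    sumUpTo k (λ b → shift x s (F b) n) ≈ shift x s (λ m → sumUpTo k (λ b → F b m)) n
  sumUpTo-shift x s k F n with s ≤ᵇ n
  ... | true  = sym (sumUpTo-*ˡ k x _)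
  ... | false = sumUpTo-zero k _ (λ _ _ → refl)


-- The ring ℤ[[α, q]]

-- ℤ's operators are opened only here, after the generic modules whose ring operators share their names.
open import Data.Integer as ℤ using (ℤ; +_; -_; _+_; _*_; -1ℤ; _^_)
import Data.Integer.Properties as ℤₚ
import Data.Integer.Tactic.RingSolver as ℤ-Solver

-- `f : PS` is read as the q-series n ↦ (α-series j ↦ f n j); ℤ⟦x⟧ serves for series in either variable.
module ℤΣ = FiniteSum ℤₚ.+-*-commutativeRing
module ℤ⟦x⟧ = PowerSeries ℤₚ.+-*-commutativeRing
module ℤ⟦x⟧Σ = FiniteSum ℤ⟦x⟧.seriesRing
module ℤ⟦α⟧⟦q⟧ = PowerSeries ℤ⟦x⟧.seriesRing

infix 4 _≈ₚ_ _≈⟨_⟩ₚ_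

_≈ₚ_ : PS → PS → Set
_≈ₚ_ = ℤ⟦α⟧⟦q⟧._≋_

_≈⟨_⟩ₚ_ : PS → ℕ → PS → Set
_≈⟨_⟩ₚ_ = ℤ⟦α⟧⟦q⟧._≋⟨_⟩_

-ₚ_ : PS → PS
-ₚ_ = ℤ⟦α⟧⟦q⟧.⊝_

Σ≤≡sumUpTo : ∀ n f → Σ≤ n f ≡ ℤΣ.sumUpTo n f
Σ≤≡sumUpTo zero    f = ≡.refl
Σ≤≡sumUpTo (suc n) f = cong (_+ f (suc n)) (Σ≤≡sumUpTo n f)

sumUpTo-apply : ∀ n (F : ℕ → ℤ⟦x⟧.Series) j → ℤ⟦x⟧Σ.sumUpTo n F j ≡ ℤΣ.sumUpTo n (λ a → F a j)
sumUpTo-apply zero    F j = ≡.refl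
sumUpTo-apply (suc n) F j = cong (_+ F (suc n) j) (sumUpTo-apply n F j)

*ₚ≈⊛ : ∀ f g → f *ₚ g ≈ₚ f ℤ⟦α⟧⟦q⟧.⊛ g
*ₚ≈⊛ f g n j = ≡.trans (Σ≤≡sumUpTo n _)
  (≡.trans (ℤΣ.sumUpTo-cong n (λ a _ → Σ≤≡sumUpTo j _)) (≡.sym (sumUpTo-apply n _ j)))

1ₚ≈𝟙 : 1ₚ ≈ₚ ℤ⟦α⟧⟦q⟧.𝟙
1ₚ≈𝟙 zero    zero    = ≡.refl
1ₚ≈𝟙 zero    (suc j) = ≡.refl
1ₚ≈𝟙 (suc n) j       = ≡.refl

psRing : CommutativeRing _ _
psRing = record { isCommutativeRing =
  isCommutativeRing-replace-*-1# ℤ⟦α⟧⟦q⟧.seriesRing *ₚ≈⊛ 1ₚ≈𝟙 }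

module P = CommutativeRing psRing

psRing≤ : ℕ → CommutativeRing _ _
psRing≤ N = record { isCommutativeRing = isCommutativeRing-coarsen psRing
  (record { refl = λ n _ j → ≡.refl ; sym = λ p n n≤N j → ≡.sym (p n n≤N j)
          ; trans = λ p q n n≤N j → ≡.trans (p n n≤N j) (q n n≤N j) })
  (λ p n _ → p n)
  (λ p q n n≤N j → cong₂ _+_ (p n n≤N j) (q n n≤N j))
  (λ p n n≤N j → cong -_ (p n n≤N j))
  *ₚ-cong≤ }
  where
  *ₚ-cong≤ : ∀ {f f′ g g′} → f ≈⟨ N ⟩ₚ f′ → g ≈⟨ N ⟩ₚ g′ → f *ₚ g ≈⟨ N ⟩ₚ f′ *ₚ g′
  *ₚ-cong≤ {f} {f′} {g} {g′} f≈f′ g≈g′ n n≤N j = ≡.trans (*ₚ≈⊛ f g n j)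
    (≡.trans (ℤ⟦α⟧⟦q⟧.⊛-cong≤ N f≈f′ g≈g′ n n≤N j) (≡.sym (*ₚ≈⊛ f′ g′ n j)))

δ-same : ∀ n → δ n n ≡ + 1
δ-same n with n ≡ᵇ n | ≡ᵇ-reflects-≡ n n
... | true  | _        = ≡.refl
... | false | ofⁿ n≢n = ⊥-elim (n≢n ≡.refl)

δ-other : ∀ {m n} → m ≢ n → δ m n ≡ + 0
δ-other {m} {n} m≢n with m ≡ᵇ n | ≡ᵇ-reflects-≡ m n
... | true  | ofʸ m≡n = ⊥-elim (m≢n m≡n)
... | false | _       = ≡.refl

δ-∸ : ∀ {k n} x → k ≤ n → δ (n ∸ k) x ≡ δ n (k ℕ.+ x)
δ-∸ {k} {n} x k≤n with n ℕ.≟ k ℕ.+ x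
... | yes ≡.refl rewrite ℕₚ.m+n∸m≡n k x = ≡.trans (δ-same x) (≡.sym (δ-same (k ℕ.+ x)))
... | no n≢k+x = ≡.trans
  (δ-other {n ∸ k} {x} λ n∸k≡x → n≢k+x (≡.trans (≡.sym (ℕₚ.m+[n∸m]≡n k≤n)) (cong (k ℕ.+_) n∸k≡x)))
  (≡.sym (δ-other n≢k+x))

δ-< : ∀ {k n} x → n < k → δ n (k ℕ.+ x) ≡ + 0
δ-< {k} {n} x n<k = δ-other {n} {k ℕ.+ x} λ { ≡.refl → ℕₚ.<⇒≱ n<k (ℕₚ.m≤m+n k x) }

mono≈monomial : ∀ c a b → mono c a b ≈ₚ ℤ⟦α⟧⟦q⟧.monomial (ℤ⟦x⟧.monomial c b) a
mono≈monomial c a b n j with n ≡ᵇ a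
... | false = ℤₚ.*-zeroʳ c
... | true with j ≡ᵇ b
...   | true  = ℤₚ.*-identityʳ c
...   | false = ℤₚ.*-zeroʳ c

mono-*ₚ : ∀ c t s f n j → (mono c t s *ₚ f) n j ≡
  (if t ≤ᵇ n then (if s ≤ᵇ j then c * f (n ∸ t) (j ∸ s) else + 0) else + 0)
mono-*ₚ c t s f n j = ≡.trans (P.*-congʳ {f} (mono≈monomial c t s) n j)
  (≡.trans (*ₚ≈⊛ (ℤ⟦α⟧⟦q⟧.monomial (ℤ⟦x⟧.monomial c s) t) f n j)
  (≡.trans (ℤ⟦α⟧⟦q⟧.monomial-⊛ (ℤ⟦x⟧.monomial c s) t f n j) shifted))
  where
  shifted : ℤ⟦α⟧⟦q⟧.shift (ℤ⟦x⟧.monomial c s) t f n j ≡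
            (if t ≤ᵇ n then (if s ≤ᵇ j then c * f (n ∸ t) (j ∸ s) else + 0) else + 0)
  shifted with t ≤ᵇ n
  ... | true  = ℤ⟦x⟧.monomial-⊛ c s (f (n ∸ t)) j
  ... | false = ≡.refl

mono-*ₚ-mono : ∀ c a b d a′ b′ → mono c a b *ₚ mono d a′ b′ ≈ₚ mono (c * d) (a ℕ.+ a′) (b ℕ.+ b′)
mono-*ₚ-mono c a b d a′ b′ = begin
  mono c a b *ₚ mono d a′ b′                 ≈⟨ P.*-cong (mono≈monomial c a b) (mono≈monomial d a′ b′) ⟩
  m c a b *ₚ m d a′ b′                       ≈⟨ *ₚ≈⊛ (m c a b) (m d a′ b′) ⟩
  m c a b ℤ⟦α⟧⟦q⟧.⊛ m d a′ b′                ≈⟨ ℤ⟦α⟧⟦q⟧.monomial-⊛-monomial _ _ a a′ ⟩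
  ℤ⟦α⟧⟦q⟧.monomial (ℤ⟦x⟧.monomial c b ℤ⟦x⟧.⊛ ℤ⟦x⟧.monomial d b′) (a ℕ.+ a′)
    ≈⟨ ℤ⟦α⟧⟦q⟧.monomial-cong (a ℕ.+ a′) (ℤ⟦x⟧.monomial-⊛-monomial c d b b′) ⟩
  m (c * d) (a ℕ.+ a′) (b ℕ.+ b′)            ≈⟨ mono≈monomial (c * d) (a ℕ.+ a′) (b ℕ.+ b′) ⟨
  mono (c * d) (a ℕ.+ a′) (b ℕ.+ b′)         ∎
  where
  open import Relation.Binary.Reasoning.Setoid P.setoid
  m : ℤ → ℕ → ℕ → PS
  m c a b = ℤ⟦α⟧⟦q⟧.monomial (ℤ⟦x⟧.monomial c b) a

x*[d*0]≡0 : ∀ x d → x * (d * + 0) ≡ + 0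
x*[d*0]≡0 x d = ≡.trans (cong (x *_) (ℤₚ.*-zeroʳ d)) (ℤₚ.*-zeroʳ x)

-- The substitutions α ↦ αq^c and (α, q) ↦ (-α, -q)

α↦αq^ : ℕ → PS → PS
α↦αq^ c f n j = if c ℕ.* j ≤ᵇ n then f (n ∸ c ℕ.* j) j else + 0

transpose : PS → ℕ → ℤ⟦x⟧.Series
transpose f j n = f n j

*ₚ-transpose : ∀ f g n j →
  (f *ₚ g) n j ≡ ℤΣ.sumUpTo j (λ b → (transpose f b ℤ⟦x⟧.⊛ transpose g (j ∸ b)) n)
*ₚ-transpose f g n j = ≡.trans (Σ≤≡sumUpTo n _)
  (≡.trans (ℤΣ.sumUpTo-cong n (λ a _ → Σ≤≡sumUpTo j _)) (ℤΣ.sumUpTo-swap n j _))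

transpose-α↦αq^ : ∀ c f j → transpose (α↦αq^ c f) j ℤ⟦x⟧.≋ ℤ⟦x⟧.shift (+ 1) (c ℕ.* j) (transpose f j)
transpose-α↦αq^ c f j n with c ℕ.* j ≤ᵇ n
... | true  = ≡.sym (ℤₚ.*-identityˡ _)
... | false = ≡.refl

α↦αq^-*ₚ : ∀ c f g → α↦αq^ c (f *ₚ g) ≈ₚ α↦αq^ c f *ₚ α↦αq^ c g
α↦αq^-*ₚ c f g n j = ≡.sym (begin
  (α↦αq^ c f *ₚ α↦αq^ c g) n j
    ≡⟨ *ₚ-transpose (α↦αq^ c f) (α↦αq^ c g) n j ⟩
  ℤΣ.sumUpTo j (λ b → (transpose (α↦αq^ c f) b ℤ⟦x⟧.⊛ transpose (α↦αq^ c g) (j ∸ b)) n)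
    ≡⟨ ℤΣ.sumUpTo-cong j (λ b b≤j → ≡.trans
         (ℤ⟦x⟧.⊛-cong (transpose-α↦αq^ c f b) (transpose-α↦αq^ c g (j ∸ b)) n)
         (≡.trans (ℤ⟦x⟧.shift-⊛-shift (+ 1) (+ 1) (c ℕ.* b) (c ℕ.* (j ∸ b))
                                       (transpose f b) (transpose g (j ∸ b)) n)
                  (cong (λ s → ℤ⟦x⟧.shift (+ 1) s (transpose f b ℤ⟦x⟧.⊛ transpose g (j ∸ b)) n)
                        (split b≤j)))) ⟩
  ℤΣ.sumUpTo j (λ b → ℤ⟦x⟧.shift (+ 1) (c ℕ.* j) (transpose f b ℤ⟦x⟧.⊛ transpose g (j ∸ b)) n)
    ≡⟨ ℤ⟦x⟧.sumUpTo-shift (+ 1) (c ℕ.* j) j (λ b → transpose f b ℤ⟦x⟧.⊛ transpose g (j ∸ b)) n ⟩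
  ℤ⟦x⟧.shift (+ 1) (c ℕ.* j) (λ m → ℤΣ.sumUpTo j (λ b → (transpose f b ℤ⟦x⟧.⊛ transpose g (j ∸ b)) m)) n
    ≡⟨ unshift ⟩
  α↦αq^ c (f *ₚ g) n j ∎)
  where
  open ≡.≡-Reasoning
  split : ∀ {b} → b ≤ j → c ℕ.* b ℕ.+ c ℕ.* (j ∸ b) ≡ c ℕ.* j
  split {b} b≤j = ≡.trans (≡.sym (ℕₚ.*-distribˡ-+ c b (j ∸ b))) (cong (c ℕ.*_) (ℕₚ.m+[n∸m]≡n b≤j))
  unshift : ℤ⟦x⟧.shift (+ 1) (c ℕ.* j)
              (λ m → ℤΣ.sumUpTo j (λ b → (transpose f b ℤ⟦x⟧.⊛ transpose g (j ∸ b)) m)) n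
          ≡ α↦αq^ c (f *ₚ g) n j
  unshift with c ℕ.* j ≤ᵇ n
  ... | true  = ≡.trans (ℤₚ.*-identityˡ _) (≡.sym (*ₚ-transpose f g (n ∸ c ℕ.* j) j))
  ... | false = ≡.refl

α↦αq^-cong : ∀ c {f g} → f ≈ₚ g → α↦αq^ c f ≈ₚ α↦αq^ c g
α↦αq^-cong c f≈g n j with c ℕ.* j ≤ᵇ n
... | true  = f≈g (n ∸ c ℕ.* j) j
... | false = ≡.refl

α↦αq^-+ₚ : ∀ c f g → α↦αq^ c (f +ₚ g) ≈ₚ α↦αq^ c f +ₚ α↦αq^ c g
α↦αq^-+ₚ c f g n j with c ℕ.* j ≤ᵇ n
... | true  = ≡.refl
... | false = ≡.refl

α↦αq^-0ₚ : ∀ c → α↦αq^ c 0ₚ ≈ₚ 0ₚ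
α↦αq^-0ₚ c n j with c ℕ.* j ≤ᵇ n
... | true  = ≡.refl
... | false = ≡.refl

α↦αq^-mono : ∀ c x a b → α↦αq^ c (mono x a b) ≈ₚ mono x (a ℕ.+ c ℕ.* b) b
α↦αq^-mono c x a b n j with j ℕ.≟ b
... | no j≢b rewrite δ-other j≢b with c ℕ.* j ≤ᵇ n
...   | true  = ≡.trans (x*[d*0]≡0 x (δ (n ∸ c ℕ.* j) a)) (≡.sym (x*[d*0]≡0 x (δ n (a ℕ.+ c ℕ.* b))))
...   | false = ≡.sym (x*[d*0]≡0 x (δ n (a ℕ.+ c ℕ.* b)))
α↦αq^-mono c x a b n j | yes ≡.refl with c ℕ.* j ≤ᵇ n | ℕₚ.≤ᵇ-reflects-≤ (c ℕ.* j) n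
...   | true  | ofʸ cj≤n =
  cong (λ d → x * (d * δ j j)) (≡.trans (δ-∸ a cj≤n) (cong (δ n) (ℕₚ.+-comm (c ℕ.* j) a)))
...   | false | ofⁿ cj≰n = ≡.sym (≡.trans
  (cong (λ d → x * (d * δ j j)) (≡.trans (cong (δ n) (ℕₚ.+-comm a (c ℕ.* j))) (δ-< a (ℕₚ.≰⇒> cj≰n))))
  (ℤₚ.*-zeroʳ x))

1ₚ≈mono : 1ₚ ≈ₚ mono (+ 1) 0 0
1ₚ≈mono n j = ≡.sym (ℤₚ.*-identityˡ _)

α↦αq^-1ₚ : ∀ c → α↦αq^ c 1ₚ ≈ₚ 1ₚ
α↦αq^-1ₚ c = begin
  α↦αq^ c 1ₚ             ≈⟨ α↦αq^-cong c 1ₚ≈mono ⟩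
  α↦αq^ c (mono (+ 1) 0 0) ≈⟨ α↦αq^-mono c (+ 1) 0 0 ⟩
  mono (+ 1) (c ℕ.* 0) 0 ≡⟨ cong (λ k → mono (+ 1) k 0) (ℕₚ.*-zeroʳ c) ⟩
  mono (+ 1) 0 0         ≈⟨ 1ₚ≈mono ⟨
  1ₚ                     ∎
  where open import Relation.Binary.Reasoning.Setoid P.setoid


psRawSemiring : RawSemiring _ _
psRawSemiring = Semiring.rawSemiring P.semiring

IsPSEndomorphism : (PS → PS) → Set
IsPSEndomorphism = IsSemiringHomomorphism psRawSemiring psRawSemiring

mkIsPSEndomorphism : ∀ {φ} →
  (∀ {f g} → f ≈ₚ g → φ f ≈ₚ φ g) →
  (∀ f g → φ (f +ₚ g) ≈ₚ φ f +ₚ φ g) → φ 0ₚ ≈ₚ 0ₚ →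
  (∀ f g → φ (f *ₚ g) ≈ₚ φ f *ₚ φ g) → φ 1ₚ ≈ₚ 1ₚ → IsPSEndomorphism φ
mkIsPSEndomorphism φ-cong φ-+ φ-0 φ-* φ-1 = record
  { isNearSemiringHomomorphism = record
    { +-isMonoidHomomorphism = record
      { isMagmaHomomorphism = record { isRelHomomorphism = record { cong = φ-cong } ; homo = φ-+ }
      ; ε-homo = φ-0 }
    ; *-homo = φ-* }
  ; 1#-homo = φ-1 }

sumFrom-additive : ∀ φ → (∀ f g → φ (f +ₚ g) ≈ₚ φ f +ₚ φ g) → φ 0ₚ ≈ₚ 0ₚ →
  ∀ a K F → φ (sumFrom a K F) ≈ₚ sumFrom a K (φ ∘ F)
sumFrom-additive φ φ-+ φ-0 a zero F with a ≤ᵇ 0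
... | true  = P.refl
... | false = φ-0
sumFrom-additive φ φ-+ φ-0 a (suc K) F with a ≤ᵇ suc K
... | true  = P.trans (φ-+ (sumFrom a K F) (F (suc K)))
                      (P.+-congʳ {φ (F (suc K))} (sumFrom-additive φ φ-+ φ-0 a K F))
... | false = φ-0

module PSEndomorphism {φ : PS → PS} (φ-hom : IsPSEndomorphism φ) where

  open IsSemiringHomomorphism φ-hom public

  φ-prodBelow : ∀ k F → φ (prodBelow k F) ≈ₚ prodBelow k (φ ∘ F)
  φ-prodBelow zero    F = 1#-homo
  φ-prodBelow (suc k) F = P.trans (*-homo (prodBelow k F) (F k)) (P.*-congʳ {φ (F k)} (φ-prodBelow k F))

  φ-sumFrom : ∀ a K F → φ (sumFrom a K F) ≈ₚ sumFrom a K (φ ∘ F)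
  φ-sumFrom = sumFrom-additive φ +-homo 0#-homo

α↦αq^-isPSEndomorphism : ∀ c → IsPSEndomorphism (α↦αq^ c)
α↦αq^-isPSEndomorphism c =
  mkIsPSEndomorphism (α↦αq^-cong c) (α↦αq^-+ₚ c) (α↦αq^-0ₚ c) (α↦αq^-*ₚ c) (α↦αq^-1ₚ c)

isPSEndomorphism-resp : ∀ {φ ψ} → IsPSEndomorphism φ → (∀ f → ψ f ≈ₚ φ f) → IsPSEndomorphism ψ
isPSEndomorphism-resp {φ} {ψ} φ-hom ψ≈φ = mkIsPSEndomorphism
  (λ {f} {g} f≈g → P.trans (ψ≈φ f) (P.trans (⟦⟧-cong f≈g) (P.sym (ψ≈φ g))))
  (λ f g → P.trans (ψ≈φ _) (P.trans (+-homo f g) (P.sym (P.+-cong (ψ≈φ f) (ψ≈φ g)))))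
  (P.trans (ψ≈φ 0ₚ) 0#-homo)
  (λ f g → P.trans (ψ≈φ _) (P.trans (*-homo f g) (P.sym (P.*-cong (ψ≈φ f) (ψ≈φ g)))))
  (P.trans (ψ≈φ 1ₚ) 1#-homo)
  where open IsSemiringHomomorphism φ-hom

negateαq : PS → PS
negateαq f n j = (-1ℤ ^ (n ℕ.+ j)) * f n j

negateαq-*ₚ : ∀ f g → negateαq (f *ₚ g) ≈ₚ negateαq f *ₚ negateαq g
negateαq-*ₚ f g n j = ≡.sym (begin
  Σ≤ n (λ a → Σ≤ j (λ b → (sign (a ℕ.+ b) * f a b) * (sign ((n ∸ a) ℕ.+ (j ∸ b)) * g (n ∸ a) (j ∸ b))))
    ≡⟨ Σ≤-cong n (λ a a≤n → Σ≤-cong j (λ b b≤j →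
         ≡.trans (interchange (sign (a ℕ.+ b)) (f a b) (sign ((n ∸ a) ℕ.+ (j ∸ b))) (g (n ∸ a) (j ∸ b)))
                 (cong (_* (f a b * g (n ∸ a) (j ∸ b))) (sign-split a≤n b≤j)))) ⟩
  Σ≤ n (λ a → Σ≤ j (λ b → sign (n ℕ.+ j) * (f a b * g (n ∸ a) (j ∸ b))))
    ≡⟨ Σ≤-cong n (λ a _ → Σ≤-*ˡ j (sign (n ℕ.+ j)) _) ⟨
  Σ≤ n (λ a → sign (n ℕ.+ j) * Σ≤ j (λ b → f a b * g (n ∸ a) (j ∸ b)))
    ≡⟨ Σ≤-*ˡ n (sign (n ℕ.+ j)) _ ⟨
  negateαq (f *ₚ g) n j ∎)
  where
  open ≡.≡-Reasoning
  open import Algebra.Properties.CommutativeSemigroup ℤₚ.*-commutativeSemigroup using (interchange)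
  open import Algebra.Properties.CommutativeSemigroup ℕₚ.+-commutativeSemigroup as ℕ+ using ()
  sign : ℕ → ℤ
  sign k = -1ℤ ^ k
  Σ≤-cong : ∀ m {u v} → (∀ i → i ≤ m → u i ≡ v i) → Σ≤ m u ≡ Σ≤ m v
  Σ≤-cong m {u} {v} u≡v =
    ≡.trans (Σ≤≡sumUpTo m u) (≡.trans (ℤΣ.sumUpTo-cong m u≡v) (≡.sym (Σ≤≡sumUpTo m v)))
  Σ≤-*ˡ : ∀ m x u → x * Σ≤ m u ≡ Σ≤ m (λ i → x * u i)
  Σ≤-*ˡ m x u =
    ≡.trans (cong (x *_) (Σ≤≡sumUpTo m u)) (≡.trans (ℤΣ.sumUpTo-*ˡ m x u) (≡.sym (Σ≤≡sumUpTo m _)))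
  sign-split : ∀ {a b} → a ≤ n → b ≤ j → sign (a ℕ.+ b) * sign ((n ∸ a) ℕ.+ (j ∸ b)) ≡ sign (n ℕ.+ j)
  sign-split {a} {b} a≤n b≤j = ≡.trans (≡.sym (ℤₚ.^-distribˡ-+-* -1ℤ (a ℕ.+ b) _)) (cong sign (≡.trans
    (ℕ+.interchange a b (n ∸ a) (j ∸ b)) (cong₂ ℕ._+_ (ℕₚ.m+[n∸m]≡n a≤n) (ℕₚ.m+[n∸m]≡n b≤j))))

negateαq-1ₚ : negateαq 1ₚ ≈ₚ 1ₚ
negateαq-1ₚ zero    zero    = ≡.refl
negateαq-1ₚ zero    (suc j) = ℤₚ.*-zeroʳ (-1ℤ ^ suc j)
negateαq-1ₚ (suc n) j       =
  ≡.trans (cong ((-1ℤ ^ (suc n ℕ.+ j)) *_) (ℤₚ.*-zeroˡ (δ j 0))) (ℤₚ.*-zeroʳ (-1ℤ ^ (suc n ℕ.+ j)))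

negateαq-isPSEndomorphism : IsPSEndomorphism negateαq
negateαq-isPSEndomorphism = mkIsPSEndomorphism
  (λ f≈g n j → cong ((-1ℤ ^ (n ℕ.+ j)) *_) (f≈g n j))
  (λ f g n j → ℤₚ.*-distribˡ-+ (-1ℤ ^ (n ℕ.+ j)) (f n j) (g n j))
  (λ n j → ℤₚ.*-zeroʳ (-1ℤ ^ (n ℕ.+ j)))
  negateαq-*ₚ
  negateαq-1ₚ

substNegαq≈α↦αq^1∘negateαq : ∀ f → substNegαq f ≈ₚ α↦αq^ 1 (negateαq f)
substNegαq≈α↦αq^1∘negateαq f M j rewrite ℕₚ.*-identityˡ j with j ≤ᵇ M | ℕₚ.≤ᵇ-reflects-≤ j M
... | true  | ofʸ j≤M = cong (λ k → (-1ℤ ^ k) * f (M ∸ j) j) (≡.sym (ℕₚ.m∸n+n≡m j≤M))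
... | false | _       = ≡.refl

substNegαq-isPSEndomorphism : IsPSEndomorphism substNegαq
substNegαq-isPSEndomorphism = isPSEndomorphism-resp
  (Compose.isSemiringHomomorphism P.trans negateαq-isPSEndomorphism (α↦αq^-isPSEndomorphism 1))
  substNegαq≈α↦αq^1∘negateαq

open import Algebra.Solver.Ring.NaturalCoefficients.Default P.commutativeSemiring
  using (solve; _:+_; _:*_; _:=_; con)

prodBelow-cong : ∀ k {F G} → (∀ i → F i ≈ₚ G i) → prodBelow k F ≈ₚ prodBelow k G
prodBelow-cong zero    F≈G = P.refl
prodBelow-cong (suc k) F≈G = P.*-cong (prodBelow-cong k F≈G) (F≈G k)

prodBelow-suc : ∀ k F → prodBelow (suc k) F ≈ₚ F 0 *ₚ prodBelow k (F ∘ suc)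
prodBelow-suc zero    F = P.trans (P.*-identityˡ (F 0)) (P.sym (P.*-identityʳ (F 0)))
prodBelow-suc (suc k) F =
  P.trans (P.*-congʳ {F (suc k)} (prodBelow-suc k F)) (P.*-assoc (F 0) (prodBelow k (F ∘ suc)) (F (suc k)))

sumFrom-cong : ∀ a K {F G} → (∀ i → F i ≈ₚ G i) → sumFrom a K F ≈ₚ sumFrom a K G
sumFrom-cong a zero    F≈G with a ≤ᵇ 0
... | true  = F≈G 0
... | false = P.refl
sumFrom-cong a (suc K) F≈G with a ≤ᵇ suc K
... | true  = P.+-cong (sumFrom-cong a K F≈G) (F≈G (suc K))
... | false = P.refl

sumFrom-cong≤ : ∀ N a K {F G} → (∀ i → F i ≈⟨ N ⟩ₚ G i) → sumFrom a K F ≈⟨ N ⟩ₚ sumFrom a K G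
sumFrom-cong≤ N a zero    F≈G with a ≤ᵇ 0
... | true  = F≈G 0
... | false = λ _ _ _ → ≡.refl
sumFrom-cong≤ N a (suc K) F≈G with a ≤ᵇ suc K
... | true  = λ n n≤N j → cong₂ _+_ (sumFrom-cong≤ N a K F≈G n n≤N j) (F≈G (suc K) n n≤N j)
... | false = λ _ _ _ → ≡.refl

sumFrom-+ₚ : ∀ a K F G → sumFrom a K (λ i → F i +ₚ G i) ≈ₚ sumFrom a K F +ₚ sumFrom a K G
sumFrom-+ₚ a zero    F G with a ≤ᵇ 0
... | true  = P.refl
... | false = P.sym (P.+-identityˡ 0ₚ)
sumFrom-+ₚ a (suc K) F G with a ≤ᵇ suc K
... | true  = P.trans (P.+-congʳ {F (suc K) +ₚ G (suc K)} (sumFrom-+ₚ a K F G))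
                      (interchange (sumFrom a K F) (sumFrom a K G) (F (suc K)) (G (suc K)))
  where open import Algebra.Properties.CommutativeSemigroup P.+-commutativeSemigroup using (interchange)
... | false = P.sym (P.+-identityˡ 0ₚ)

sumFrom-*ₚˡ : ∀ f a K F → f *ₚ sumFrom a K F ≈ₚ sumFrom a K (λ i → f *ₚ F i)
sumFrom-*ₚˡ f = sumFrom-additive (f *ₚ_) (P.distribˡ f) (P.zeroʳ f)

sumFrom--ₚ : ∀ a K F → -ₚ sumFrom a K F ≈ₚ sumFrom a K (-ₚ_ ∘ F)
sumFrom--ₚ = sumFrom-additive -ₚ_ (λ f g → P.sym (-‿+-comm f g)) -0#≈0#
  where open import Algebra.Properties.Ring P.ring using (-‿+-comm; -0#≈0#)

sumFrom-1-suc : ∀ K F → sumFrom 1 (suc K) F ≈ₚ F 1 +ₚ sumFrom 1 K (F ∘ suc)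
sumFrom-1-suc zero    F = P.trans (P.+-identityˡ (F 1)) (P.sym (P.+-identityʳ (F 1)))
sumFrom-1-suc (suc K) F = P.trans (P.+-congʳ {F (suc (suc K))} (sumFrom-1-suc K F))
                                  (P.+-assoc (F 1) (sumFrom 1 K (F ∘ suc)) (F (suc (suc K))))

*ₚ-onePlusαq^ : ∀ f t n j → (f *ₚ onePlusαq^ t) n j ≡ f n j + (mono (+ 1) t 1 *ₚ f) n j
*ₚ-onePlusαq^ f t n j = ≡.trans (P.distribˡ f 1ₚ (mono (+ 1) t 1) n j)
  (cong₂ _+_ (P.*-identityʳ f n j) (P.*-comm f (mono (+ 1) t 1) n j))

mono-*ₚ-below : ∀ c t s f {n} j → n < t → (mono c t s *ₚ f) n j ≡ + 0
mono-*ₚ-below c t s f {n} j n<t with t ≤ᵇ n | ℕₚ.≤ᵇ-reflects-≤ t n | mono-*ₚ c t s f n j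
... | true  | ofʸ t≤n | _ = ⊥-elim (ℕₚ.<⇒≱ n<t t≤n)
... | false | _       | eq = eq

*ₚ-onePlusαq^-below : ∀ f t {n} j → n < t → (f *ₚ onePlusαq^ t) n j ≡ f n j
*ₚ-onePlusαq^-below f t {n} j n<t = ≡.trans (*ₚ-onePlusαq^ f t n j)
  (≡.trans (cong (_+_ (f n j)) (mono-*ₚ-below (+ 1) t 1 f j n<t)) (ℤₚ.+-identityʳ (f n j)))

q^[k*k]-*ₚ-below : ∀ c k f {n} j → n < k → (mono c (k ℕ.* k) 0 *ₚ f) n j ≡ + 0
q^[k*k]-*ₚ-below c k@(suc _) f j n<k = mono-*ₚ-below c (k ℕ.* k) 0 f j (ℕₚ.<-≤-trans n<k (ℕₚ.m≤m*n k k))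

sumFrom-stable : ∀ {F} → (∀ k {n} j → n < k → F k n j ≡ + 0) →
  ∀ {n K K′} j → n ≤ K → K ≤ K′ → sumFrom 1 K′ F n j ≡ sumFrom 1 K F n j
sumFrom-stable {F} F-below {n} {K} {K′} j n≤K K≤K′ =
  ≡.trans (cong (λ k → sumFrom 1 k F n j) (≡.sym (ℕₚ.m∸n+n≡m K≤K′))) (extend (K′ ∸ K))
  where
  extend : ∀ d → sumFrom 1 (d ℕ.+ K) F n j ≡ sumFrom 1 K F n j
  extend zero    = ≡.refl
  extend (suc d) = ≡.trans (cong (_+_ (sumFrom 1 (d ℕ.+ K) F n j))
                                 (F-below (suc (d ℕ.+ K)) j (s≤s (ℕₚ.≤-trans n≤K (ℕₚ.m≤n+m K d)))))
                           (≡.trans (ℤₚ.+-identityʳ _) (extend d))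

-- q-Pochhammer symbols

invOnePlusαq^ : ℕ → PS
invOnePlusαq^ m n j = δ n (m ℕ.* j) * (-1ℤ ^ j)

onePlusαq^-inverse : ∀ m → onePlusαq^ m *ₚ invOnePlusαq^ m ≈ₚ 1ₚ
onePlusαq^-inverse m n j = ≡.trans (P.*-comm (onePlusαq^ m) (invOnePlusαq^ m) n j)
  (≡.trans (*ₚ-onePlusαq^ (invOnePlusαq^ m) m n j)
  (≡.trans (cong (_+_ (invOnePlusαq^ m n j)) (mono-*ₚ (+ 1) m 1 (invOnePlusαq^ m) n j)) (coefficient j)))
  where
  coefficient : ∀ j → invOnePlusαq^ m n j +
    (if m ≤ᵇ n then (if 1 ≤ᵇ j then + 1 * invOnePlusαq^ m (n ∸ m) (j ∸ 1) else + 0) else + 0) ≡ 1ₚ n j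
  coefficient zero rewrite ℕₚ.*-zeroʳ m with m ≤ᵇ n
  ... | true  = ℤₚ.+-identityʳ _
  ... | false = ℤₚ.+-identityʳ _
  coefficient (suc j) rewrite ℕₚ.*-suc m j with m ≤ᵇ n | ℕₚ.≤ᵇ-reflects-≤ m n
  ... | true  | ofʸ m≤n rewrite δ-∸ (m ℕ.* j) m≤n =
    ≡.trans (cancel (δ n (m ℕ.+ m ℕ.* j)) (-1ℤ ^ j)) (≡.sym (ℤₚ.*-zeroʳ (δ n 0)))
    where
    cancel : ∀ x s → x * (-1ℤ * s) + + 1 * (x * s) ≡ + 0
    cancel = ℤ-Solver.solve-∀
  ... | false | ofⁿ m≰n rewrite δ-< (m ℕ.* j) (ℕₚ.≰⇒> m≰n) =
    ≡.trans (ℤₚ.+-identityʳ _) (≡.trans (ℤₚ.*-zeroˡ (-1ℤ ^ suc j)) (≡.sym (ℤₚ.*-zeroʳ (δ n 0))))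

α↦αq^-onePlusαq^ : ∀ c t → α↦αq^ c (onePlusαq^ t) ≈ₚ onePlusαq^ (c ℕ.+ t)
α↦αq^-onePlusαq^ c t = P.trans (+-homo 1ₚ (mono (+ 1) t 1)) (P.+-cong 1#-homo (P.trans
  (α↦αq^-mono c (+ 1) t 1) (P.reflexive (cong (λ k → mono (+ 1) k 1)
    (≡.trans (cong (t ℕ.+_) (ℕₚ.*-identityʳ c)) (ℕₚ.+-comm t c))))))
  where open PSEndomorphism (α↦αq^-isPSEndomorphism c)

α↦αq^-invOnePlusαq^ : ∀ c m → α↦αq^ c (invOnePlusαq^ m) ≈ₚ invOnePlusαq^ (c ℕ.+ m)
α↦αq^-invOnePlusαq^ c m n j rewrite ℕₚ.*-distribʳ-+ j c m
  with c ℕ.* j ≤ᵇ n | ℕₚ.≤ᵇ-reflects-≤ (c ℕ.* j) n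
... | true  | ofʸ cj≤n = cong (_* (-1ℤ ^ j)) (δ-∸ (m ℕ.* j) cj≤n)
... | false | ofⁿ cj≰n =
  ≡.sym (≡.trans (cong (_* (-1ℤ ^ j)) (δ-< (m ℕ.* j) (ℕₚ.≰⇒> cj≰n))) (ℤₚ.*-zeroˡ (-1ℤ ^ j)))

-1^[2k]≡1 : ∀ k → -1ℤ ^ (2 ℕ.* k) ≡ + 1
-1^[2k]≡1 k = ≡.trans (≡.sym (ℤₚ.^-*-assoc -1ℤ 2 k)) (ℤₚ.^-zeroˡ k)

-1^[n*n]≡-1^n : ∀ n → -1ℤ ^ (n ℕ.* n) ≡ -1ℤ ^ n
-1^[n*n]≡-1^n zero    = ≡.refl
-1^[n*n]≡-1^n (suc n) = begin
  -1ℤ ^ (suc n ℕ.* suc n)                   ≡⟨ cong (-1ℤ ^_) (square n) ⟩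
  -1ℤ ^ (2 ℕ.* n ℕ.+ suc (n ℕ.* n))         ≡⟨ ℤₚ.^-distribˡ-+-* -1ℤ (2 ℕ.* n) (suc (n ℕ.* n)) ⟩
  -1ℤ ^ (2 ℕ.* n) * (-1ℤ * -1ℤ ^ (n ℕ.* n)) ≡⟨ cong₂ (λ x y → x * (-1ℤ * y)) (-1^[2k]≡1 n) (-1^[n*n]≡-1^n n) ⟩
  + 1 * (-1ℤ * -1ℤ ^ n)                     ≡⟨ ℤₚ.*-identityˡ _ ⟩
  -1ℤ ^ suc n                               ∎
  where
  open ≡.≡-Reasoning
  square : ∀ n → (1 ℕ.+ n) ℕ.* (1 ℕ.+ n) ≡ 2 ℕ.* n ℕ.+ (1 ℕ.+ n ℕ.* n)
  square = ℕ-Solver.solve-∀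

sqTerm : ℕ → PS
sqTerm n = mono (-1ℤ ^ n) (n ℕ.* n) 0

substNegαq-q^[n*n] : ∀ n → substNegαq (mono (+ 1) (n ℕ.* n) 0) ≈ₚ sqTerm n
substNegαq-q^[n*n] n M zero with M ℕ.≟ n ℕ.* n
... | yes ≡.refl rewrite δ-same (n ℕ.* n) = cong (_* + 1) (-1^[n*n]≡-1^n n)
... | no M≢n²    rewrite δ-other M≢n² = ≡.trans (ℤₚ.*-zeroʳ (-1ℤ ^ M)) (≡.sym (ℤₚ.*-zeroʳ (-1ℤ ^ n)))
substNegαq-q^[n*n] n M (suc j) with suc j ≤ᵇ M
... | true  = ≡.trans (cong ((-1ℤ ^ M) *_) (x*[d*0]≡0 (+ 1) (δ (M ∸ suc j) (n ℕ.* n))))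
                      (≡.trans (ℤₚ.*-zeroʳ (-1ℤ ^ M)) (≡.sym (x*[d*0]≡0 (-1ℤ ^ n) (δ M (n ℕ.* n)))))
... | false = ≡.sym (x*[d*0]≡0 (-1ℤ ^ n) (δ M (n ℕ.* n)))

substNegαq-invOneMinusαq^ : ∀ i → substNegαq (invOneMinusαq^ (2 ℕ.* i)) ≈ₚ invOnePlusαq^ (1 ℕ.+ 2 ℕ.* i)
substNegαq-invOneMinusαq^ i M j with j ≤ᵇ M | ℕₚ.≤ᵇ-reflects-≤ j M
... | false | ofⁿ j≰M = ≡.sym (≡.trans (cong (_* (-1ℤ ^ j)) (δ-< (2 ℕ.* i ℕ.* j) (ℕₚ.≰⇒> j≰M)))
                                        (ℤₚ.*-zeroˡ (-1ℤ ^ j)))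
... | true  | ofʸ j≤M rewrite δ-∸ (2 ℕ.* i ℕ.* j) j≤M with M ℕ.≟ j ℕ.+ 2 ℕ.* i ℕ.* j
...   | no M≢ rewrite δ-other M≢ = ≡.trans (ℤₚ.*-zeroʳ (-1ℤ ^ M)) (≡.sym (ℤₚ.*-zeroˡ (-1ℤ ^ j)))
...   | yes ≡.refl rewrite δ-same (j ℕ.+ 2 ℕ.* i ℕ.* j) = begin
  -1ℤ ^ (j ℕ.+ 2 ℕ.* i ℕ.* j) * + 1         ≡⟨ ℤₚ.*-identityʳ _ ⟩
  -1ℤ ^ (j ℕ.+ 2 ℕ.* i ℕ.* j)               ≡⟨ ℤₚ.^-distribˡ-+-* -1ℤ j (2 ℕ.* i ℕ.* j) ⟩
  -1ℤ ^ j * -1ℤ ^ (2 ℕ.* i ℕ.* j)           ≡⟨ cong (λ k → -1ℤ ^ j * -1ℤ ^ k) (ℕₚ.*-assoc 2 i j) ⟩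
  -1ℤ ^ j * -1ℤ ^ (2 ℕ.* (i ℕ.* j))         ≡⟨ cong (-1ℤ ^ j *_) (-1^[2k]≡1 (i ℕ.* j)) ⟩
  -1ℤ ^ j * + 1                             ≡⟨ ℤₚ.*-comm (-1ℤ ^ j) (+ 1) ⟩
  + 1 * -1ℤ ^ j                             ∎
  where open ≡.≡-Reasoning

negαPoch : ℕ → PS
negαPoch B = prodBelow B onePlusαq^

negαq²Poch : ℕ → PS
negαq²Poch B = prodBelow B (λ i → onePlusαq^ (2 ℕ.+ i))

invNegαqPoch : ℕ → PS
invNegαqPoch n = prodBelow n (λ i → invOnePlusαq^ (1 ℕ.+ 2 ℕ.* i))

pochQuotient : ℕ → ℕ → PS
pochQuotient B n = negαPoch B *ₚ invNegαqPoch n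

negαPoch-split : ∀ B → negαPoch (2 ℕ.+ B) ≈ₚ onePlusαq^ 0 *ₚ (onePlusαq^ 1 *ₚ negαq²Poch B)
negαPoch-split B = P.trans (prodBelow-suc (suc B) onePlusαq^)
  (P.*-congˡ {onePlusαq^ 0} (prodBelow-suc B (onePlusαq^ ∘ suc)))

α↦αq²-negαPoch : ∀ B → α↦αq^ 2 (negαPoch B) ≈ₚ negαq²Poch B
α↦αq²-negαPoch B = P.trans (φ-prodBelow B onePlusαq^) (prodBelow-cong B (α↦αq^-onePlusαq^ 2))
  where open PSEndomorphism (α↦αq^-isPSEndomorphism 2)

invNegαqPoch-suc : ∀ n → invNegαqPoch (1 ℕ.+ n) ≈ₚ invOnePlusαq^ 1 *ₚ α↦αq^ 2 (invNegαqPoch n)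
invNegαqPoch-suc n = P.trans (prodBelow-suc n _) (P.*-congˡ {invOnePlusαq^ 1} (P.sym (P.trans
  (φ-prodBelow n (λ i → invOnePlusαq^ (1 ℕ.+ 2 ℕ.* i)))
  (prodBelow-cong n (λ i → P.trans (α↦αq^-invOnePlusαq^ 2 (1 ℕ.+ 2 ℕ.* i))
                                    (P.reflexive (cong invOnePlusαq^ (odd-suc i))))))))
  where
  open PSEndomorphism (α↦αq^-isPSEndomorphism 2)
  odd-suc : ∀ i → 2 ℕ.+ (1 ℕ.+ 2 ℕ.* i) ≡ 1 ℕ.+ 2 ℕ.* (1 ℕ.+ i)
  odd-suc = ℕ-Solver.solve-∀

pochQuotient-step : ∀ B n → pochQuotient B n ≈ₚ onePlusαq^ (1 ℕ.+ 2 ℕ.* n) *ₚ pochQuotient B (1 ℕ.+ n)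
pochQuotient-step B n = P.sym (begin
  a *ₚ (negαPoch B *ₚ (invNegαqPoch n *ₚ j))  ≈⟨ rearrange a (negαPoch B) (invNegαqPoch n) j ⟩
  pochQuotient B n *ₚ (a *ₚ j)                ≈⟨ P.*-congˡ {pochQuotient B n} (onePlusαq^-inverse (1 ℕ.+ 2 ℕ.* n)) ⟩
  pochQuotient B n *ₚ 1ₚ                      ≈⟨ P.*-identityʳ (pochQuotient B n) ⟩
  pochQuotient B n                            ∎)
  where
  open import Relation.Binary.Reasoning.Setoid P.setoid
  a : PS
  a = onePlusαq^ (1 ℕ.+ 2 ℕ.* n)
  j : PS
  j = invOnePlusαq^ (1 ℕ.+ 2 ℕ.* n)
  rearrange : ∀ a h i j → a *ₚ (h *ₚ (i *ₚ j)) ≈ₚ (h *ₚ i) *ₚ (a *ₚ j)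
  rearrange = solve 4 (λ a h i j → a :* (h :* (i :* j)) := (h :* i) :* (a :* j)) P.refl

α↦αq²-pochQuotient : ∀ B n → onePlusαq^ 0 *ₚ α↦αq^ 2 (pochQuotient B n) ≈ₚ pochQuotient (2 ℕ.+ B) (1 ℕ.+ n)
α↦αq²-pochQuotient B n = P.sym (begin
  negαPoch (2 ℕ.+ B) *ₚ invNegαqPoch (1 ℕ.+ n)
    ≈⟨ P.*-cong (negαPoch-split B) (invNegαqPoch-suc n) ⟩
  (a₀ *ₚ (a₁ *ₚ negαq²Poch B)) *ₚ (j₁ *ₚ σ (invNegαqPoch n))
    ≈⟨ rearrange a₀ a₁ (negαq²Poch B) j₁ (σ (invNegαqPoch n)) ⟩
  (a₀ *ₚ (negαq²Poch B *ₚ σ (invNegαqPoch n))) *ₚ (a₁ *ₚ j₁)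
    ≈⟨ P.*-congˡ {a₀ *ₚ (negαq²Poch B *ₚ σ (invNegαqPoch n))} (onePlusαq^-inverse 1) ⟩
  (a₀ *ₚ (negαq²Poch B *ₚ σ (invNegαqPoch n))) *ₚ 1ₚ
    ≈⟨ P.*-identityʳ _ ⟩
  a₀ *ₚ (negαq²Poch B *ₚ σ (invNegαqPoch n))
    ≈⟨ P.*-congˡ {a₀} (P.*-congʳ {σ (invNegαqPoch n)} (α↦αq²-negαPoch B)) ⟨
  a₀ *ₚ (σ (negαPoch B) *ₚ σ (invNegαqPoch n))
    ≈⟨ P.*-congˡ {a₀} (*-homo (negαPoch B) (invNegαqPoch n)) ⟨
  a₀ *ₚ σ (pochQuotient B n) ∎)
  where
  open import Relation.Binary.Reasoning.Setoid P.setoid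
  open PSEndomorphism (α↦αq^-isPSEndomorphism 2)
  σ : PS → PS
  σ = α↦αq^ 2
  a₀ : PS
  a₀ = onePlusαq^ 0
  a₁ : PS
  a₁ = onePlusαq^ 1
  j₁ : PS
  j₁ = invOnePlusαq^ 1
  rearrange : ∀ a₀ a₁ p j s → (a₀ *ₚ (a₁ *ₚ p)) *ₚ (j *ₚ s) ≈ₚ (a₀ *ₚ (p *ₚ s)) *ₚ (a₁ *ₚ j)
  rearrange = solve 5 (λ a₀ a₁ p j s → (a₀ :* (a₁ :* p)) :* (j :* s) := (a₀ :* (p :* s)) :* (a₁ :* j)) P.refl

α αq : PS
α  = mono (+ 1) 0 1
αq = mono (+ 1) 1 1

-ₚmono : ∀ c a b → -ₚ mono c a b ≈ₚ mono (- c) a b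
-ₚmono c a b n j = ℤₚ.neg-distribˡ-* c _

sqTerm-*ₚ-αq^ : ∀ n → sqTerm n *ₚ mono (+ 1) (1 ℕ.+ 2 ℕ.* n) 1 ≈ₚ -ₚ (α *ₚ sqTerm (1 ℕ.+ n))
sqTerm-*ₚ-αq^ n = begin
  sqTerm n *ₚ mono (+ 1) (1 ℕ.+ 2 ℕ.* n) 1
    ≈⟨ mono-*ₚ-mono (-1ℤ ^ n) (n ℕ.* n) 0 (+ 1) (1 ℕ.+ 2 ℕ.* n) 1 ⟩
  mono (-1ℤ ^ n * + 1) (n ℕ.* n ℕ.+ (1 ℕ.+ 2 ℕ.* n)) 1
    ≡⟨ cong₂ (λ c k → mono c k 1) sign (square n) ⟩
  mono (- (+ 1 * -1ℤ ^ suc n)) (suc n ℕ.* suc n) 1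
    ≈⟨ -ₚmono (+ 1 * -1ℤ ^ suc n) (suc n ℕ.* suc n) 1 ⟨
  -ₚ mono (+ 1 * -1ℤ ^ suc n) (0 ℕ.+ suc n ℕ.* suc n) (1 ℕ.+ 0)
    ≈⟨ P.-‿cong (mono-*ₚ-mono (+ 1) 0 1 (-1ℤ ^ suc n) (suc n ℕ.* suc n) 0) ⟨
  -ₚ (α *ₚ sqTerm (1 ℕ.+ n)) ∎
  where
  open import Relation.Binary.Reasoning.Setoid P.setoid
  square : ∀ n → n ℕ.* n ℕ.+ (1 ℕ.+ 2 ℕ.* n) ≡ (1 ℕ.+ n) ℕ.* (1 ℕ.+ n)
  square = ℕ-Solver.solve-∀
  sign : -1ℤ ^ n * + 1 ≡ - (+ 1 * -1ℤ ^ suc n)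
  sign = ≡.trans (ℤₚ.*-identityʳ (-1ℤ ^ n)) (≡.sym (≡.trans (cong -_ (≡.trans (ℤₚ.*-identityˡ (-1ℤ ^ suc n))
    (ℤₚ.-1*i≡-i (-1ℤ ^ n)))) (ℤₚ.neg-involutive (-1ℤ ^ n))))

α*ₚsqTerm1 : α *ₚ sqTerm 1 ≈ₚ -ₚ αq
α*ₚsqTerm1 = P.trans (mono-*ₚ-mono (+ 1) 0 1 (-1ℤ ^ 1) 1 0) (P.sym (-ₚmono (+ 1) 1 1))

α↦αq²-sqTerm-*ₚ : ∀ n f → α↦αq^ 2 (sqTerm n *ₚ f) ≈ₚ sqTerm n *ₚ α↦αq^ 2 f
α↦αq²-sqTerm-*ₚ n f = P.trans (*-homo (sqTerm n) f) (P.*-congʳ {α↦αq^ 2 f}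
  (P.trans (α↦αq^-mono 2 (-1ℤ ^ n) (n ℕ.* n) 0)
           (P.reflexive (cong (λ k → mono (-1ℤ ^ n) k 0) (ℕₚ.+-identityʳ (n ℕ.* n))))))
  where open PSEndomorphism (α↦αq^-isPSEndomorphism 2)

negαPoch-stable : ∀ {n B B′} j → n < B → B ≤ B′ → negαPoch B′ n j ≡ negαPoch B n j
negαPoch-stable {n} {B} {B′} j n<B B≤B′ =
  ≡.trans (cong (λ k → negαPoch k n j) (≡.sym (ℕₚ.m∸n+n≡m B≤B′))) (extend (B′ ∸ B))
  where
  extend : ∀ d → negαPoch (d ℕ.+ B) n j ≡ negαPoch B n j
  extend zero    = ≡.refl
  extend (suc d) = ≡.trans (*ₚ-onePlusαq^-below (negαPoch (d ℕ.+ B)) (d ℕ.+ B) j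
                             (ℕₚ.<-≤-trans n<B (ℕₚ.m≤n+m B d)))
                           (extend d)

pochQuotient-stable : ∀ {N B B′} n → N < B → B ≤ B′ → pochQuotient B n ≈⟨ N ⟩ₚ pochQuotient B′ n
pochQuotient-stable {N} {B} {B′} n N<B B≤B′ = P≤.*-cong {negαPoch B} {negαPoch B′} {invNegαqPoch n}
  (λ m m≤N j → ≡.sym (negαPoch-stable j (ℕₚ.≤-<-trans m≤N N<B) B≤B′)) P≤.refl
  where module P≤ = CommutativeRing (psRing≤ N)

-- Telescoping (-α;q)_B ψ(-αq;-q)

lhsTerm : ℕ → ℕ → PS
lhsTerm B n = sqTerm n *ₚ pochQuotient B n

lhsApprox : ℕ → ℕ → PS
lhsApprox B K = sumFrom 1 K (lhsTerm B)

lhsTerm-step : ∀ B n →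
  lhsTerm B n ≈ₚ (sqTerm n *ₚ pochQuotient B (1 ℕ.+ n)) +ₚ (-ₚ (α *ₚ lhsTerm B (1 ℕ.+ n)))
lhsTerm-step B n = begin
  t *ₚ pochQuotient B n                 ≈⟨ P.*-congˡ {t} (pochQuotient-step B n) ⟩
  t *ₚ ((1ₚ +ₚ m) *ₚ e)                 ≈⟨ expand t m e ⟩
  (t *ₚ e) +ₚ ((t *ₚ m) *ₚ e)           ≈⟨ P.+-congˡ {t *ₚ e} (P.*-congʳ {e} (sqTerm-*ₚ-αq^ n)) ⟩
  (t *ₚ e) +ₚ ((-ₚ (α *ₚ t′)) *ₚ e)     ≈⟨ P.+-congˡ {t *ₚ e} (P.sym (-‿distribˡ-* (α *ₚ t′) e)) ⟩
  (t *ₚ e) +ₚ (-ₚ ((α *ₚ t′) *ₚ e))     ≈⟨ P.+-congˡ {t *ₚ e} (P.-‿cong (P.*-assoc α t′ e)) ⟩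
  (t *ₚ e) +ₚ (-ₚ (α *ₚ (t′ *ₚ e)))     ∎
  where
  open import Relation.Binary.Reasoning.Setoid P.setoid
  open import Algebra.Properties.Ring P.ring using (-‿distribˡ-*)
  t : PS
  t = sqTerm n
  t′ : PS
  t′ = sqTerm (1 ℕ.+ n)
  m : PS
  m = mono (+ 1) (1 ℕ.+ 2 ℕ.* n) 1
  e : PS
  e = pochQuotient B (1 ℕ.+ n)
  expand : ∀ t m e → t *ₚ ((1ₚ +ₚ m) *ₚ e) ≈ₚ (t *ₚ e) +ₚ ((t *ₚ m) *ₚ e)
  expand = solve 3 (λ t m e → t :* ((con 1 :+ m) :* e) := (t :* e) :+ ((t :* m) :* e)) P.refl

lhsApprox-telescope : ∀ B K → lhsApprox B K ≈ₚ
  sumFrom 1 K (λ n → sqTerm n *ₚ pochQuotient B (1 ℕ.+ n)) +ₚ (-ₚ (α *ₚ sumFrom 1 K (lhsTerm B ∘ suc)))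
lhsApprox-telescope B K = begin
  sumFrom 1 K (lhsTerm B)
    ≈⟨ sumFrom-cong 1 K (lhsTerm-step B) ⟩
  sumFrom 1 K (λ n → (sqTerm n *ₚ pochQuotient B (1 ℕ.+ n)) +ₚ (-ₚ (α *ₚ lhsTerm B (1 ℕ.+ n))))
    ≈⟨ sumFrom-+ₚ 1 K _ _ ⟩
  sumFrom 1 K (λ n → sqTerm n *ₚ pochQuotient B (1 ℕ.+ n)) +ₚ sumFrom 1 K (λ n → -ₚ (α *ₚ lhsTerm B (1 ℕ.+ n)))
    ≈⟨ P.+-congˡ {sumFrom 1 K (λ n → sqTerm n *ₚ pochQuotient B (1 ℕ.+ n))} (P.sym (P.trans
         (P.-‿cong (sumFrom-*ₚˡ α 1 K (lhsTerm B ∘ suc))) (sumFrom--ₚ 1 K _))) ⟩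
  sumFrom 1 K (λ n → sqTerm n *ₚ pochQuotient B (1 ℕ.+ n)) +ₚ (-ₚ (α *ₚ sumFrom 1 K (lhsTerm B ∘ suc))) ∎
  where open import Relation.Binary.Reasoning.Setoid P.setoid

α↦αq²-lhsApprox : ∀ B K → onePlusαq^ 0 *ₚ α↦αq^ 2 (lhsApprox B K) ≈ₚ
  sumFrom 1 K (λ n → sqTerm n *ₚ pochQuotient (2 ℕ.+ B) (1 ℕ.+ n))
α↦αq²-lhsApprox B K = P.trans (P.*-congˡ {onePlusαq^ 0} (φ-sumFrom 1 K (lhsTerm B)))
  (P.trans (sumFrom-*ₚˡ (onePlusαq^ 0) 1 K _) (sumFrom-cong 1 K termwise))
  where
  open PSEndomorphism (α↦αq^-isPSEndomorphism 2)
  termwise : ∀ n → onePlusαq^ 0 *ₚ α↦αq^ 2 (lhsTerm B n) ≈ₚ sqTerm n *ₚ pochQuotient (2 ℕ.+ B) (1 ℕ.+ n)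
  termwise n = P.trans (P.*-congˡ {onePlusαq^ 0} (α↦αq²-sqTerm-*ₚ n (pochQuotient B n)))
    (P.trans (swap (onePlusαq^ 0) (sqTerm n) (α↦αq^ 2 (pochQuotient B n)))
             (P.*-congˡ {sqTerm n} (α↦αq²-pochQuotient B n)))
    where
    swap : ∀ a t x → a *ₚ (t *ₚ x) ≈ₚ t *ₚ (a *ₚ x)
    swap = solve 3 (λ a t x → a :* (t :* x) := t :* (a :* x)) P.refl

α*lhsTerm1 : ∀ b → α *ₚ lhsTerm (2 ℕ.+ b) 1 ≈ₚ -ₚ (αq *ₚ (onePlusαq^ 0 *ₚ negαq²Poch b))
α*lhsTerm1 b = begin
  α *ₚ (sqTerm 1 *ₚ e)           ≈⟨ P.*-assoc α (sqTerm 1) e ⟨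
  (α *ₚ sqTerm 1) *ₚ e           ≈⟨ P.*-congʳ {e} α*ₚsqTerm1 ⟩
  (-ₚ αq) *ₚ e                   ≈⟨ -‿distribˡ-* αq e ⟨
  -ₚ (αq *ₚ e)                   ≈⟨ P.-‿cong (P.*-congˡ {αq} e≈) ⟩
  -ₚ (αq *ₚ (a₀ *ₚ negαq²Poch b)) ∎
  where
  open import Relation.Binary.Reasoning.Setoid P.setoid
  open import Algebra.Properties.Ring P.ring using (-‿distribˡ-*)
  e : PS
  e  = pochQuotient (2 ℕ.+ b) 1
  a₀ : PS
  a₀ = onePlusαq^ 0
  e≈ : e ≈ₚ a₀ *ₚ negαq²Poch b
  e≈ = begin
    negαPoch (2 ℕ.+ b) *ₚ (1ₚ *ₚ invOnePlusαq^ 1)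
      ≈⟨ P.*-congʳ {1ₚ *ₚ invOnePlusαq^ 1} (negαPoch-split b) ⟩
    (a₀ *ₚ (onePlusαq^ 1 *ₚ negαq²Poch b)) *ₚ (1ₚ *ₚ invOnePlusαq^ 1)
      ≈⟨ rearrange a₀ (onePlusαq^ 1) (negαq²Poch b) (invOnePlusαq^ 1) ⟩
    (a₀ *ₚ negαq²Poch b) *ₚ (onePlusαq^ 1 *ₚ invOnePlusαq^ 1)
      ≈⟨ P.*-congˡ {a₀ *ₚ negαq²Poch b} (onePlusαq^-inverse 1) ⟩
    (a₀ *ₚ negαq²Poch b) *ₚ 1ₚ
      ≈⟨ P.*-identityʳ _ ⟩
    a₀ *ₚ negαq²Poch b ∎
    where
    rearrange : ∀ a₀ a₁ p j → (a₀ *ₚ (a₁ *ₚ p)) *ₚ (1ₚ *ₚ j) ≈ₚ (a₀ *ₚ p) *ₚ (a₁ *ₚ j)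
    rearrange = solve 4 (λ a₀ a₁ p j → (a₀ :* (a₁ :* p)) :* (con 1 :* j) := (a₀ :* p) :* (a₁ :* j)) P.refl

-- The generating function of P_do

odd? : ∀ n → Dec (Odd n)
odd? zero                = no λ ()
odd? (suc zero)          = yes (0 , ≡.refl)
odd? (suc (suc n))       = map′ step back (odd? n)
  where
  step : Odd n → Odd (suc (suc n))
  step (k , ≡.refl) = suc k , cong suc (≡.sym (ℕₚ.*-suc 2 k))
  back : Odd (suc (suc n)) → Odd n
  back (zero  , ())
  back (suc k , e)  = k , ℕₚ.suc-injective (≡.trans (ℕₚ.suc-injective e) (ℕₚ.*-suc 2 k))

oddMonomial : ℕ → PS
oddMonomial b with odd? b
... | yes _ = mono (+ 1) b 1
... | no  _ = 0ₚ

-- Σ α^l(ν) q^|ν| over the ν ∈ P_do whose parts are all < b.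
pdoSeries : ℕ → PS
pdoSeries zero    = 0ₚ
pdoSeries (suc b) = (pdoSeries b *ₚ onePlusαq^ b) +ₚ oddMonomial b

α↦αq²-oddMonomial : ∀ b → α↦αq^ 2 (oddMonomial b) ≈ₚ oddMonomial (2 ℕ.+ b)
α↦αq²-oddMonomial b with odd? b
... | yes _ = P.trans (α↦αq^-mono 2 (+ 1) b 1) (P.reflexive (cong (λ k → mono (+ 1) k 1) (ℕₚ.+-comm b 2)))
... | no  _ = α↦αq^-0ₚ 2

pdoSeries-α↦αq² : ∀ b → α↦αq^ 2 (pdoSeries b) +ₚ (αq *ₚ negαq²Poch b) ≈ₚ pdoSeries (2 ℕ.+ b)
pdoSeries-α↦αq² zero = begin
  α↦αq^ 2 0ₚ +ₚ (αq *ₚ 1ₚ)  ≈⟨ P.+-cong (α↦αq^-0ₚ 2) (P.*-identityʳ αq) ⟩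
  0ₚ +ₚ αq               ≈⟨ P.+-congʳ {αq} (P.trans (P.*-congʳ {onePlusαq^ 1}
                              (P.trans (P.+-identityʳ (0ₚ *ₚ onePlusαq^ 0)) (P.zeroˡ (onePlusαq^ 0))))
                              (P.zeroˡ (onePlusαq^ 1))) ⟨
  pdoSeries 2            ∎
  where open import Relation.Binary.Reasoning.Setoid P.setoid
pdoSeries-α↦αq² (suc b) = begin
  σ ((D b *ₚ onePlusαq^ b) +ₚ oddMonomial b) +ₚ (αq *ₚ (negαq²Poch b *ₚ a))
    ≈⟨ P.+-congʳ {αq *ₚ (negαq²Poch b *ₚ a)} (P.trans (+-homo (D b *ₚ onePlusαq^ b) (oddMonomial b))
         (P.+-cong (P.trans (*-homo (D b) (onePlusαq^ b)) (P.*-congˡ {σ (D b)} (α↦αq^-onePlusαq^ 2 b)))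
                   (α↦αq²-oddMonomial b))) ⟩
  ((σ (D b) *ₚ a) +ₚ oddMonomial (2 ℕ.+ b)) +ₚ (αq *ₚ (negαq²Poch b *ₚ a))
    ≈⟨ regroup (σ (D b)) a (oddMonomial (2 ℕ.+ b)) αq (negαq²Poch b) ⟩
  ((σ (D b) +ₚ (αq *ₚ negαq²Poch b)) *ₚ a) +ₚ oddMonomial (2 ℕ.+ b)
    ≈⟨ P.+-congʳ {oddMonomial (2 ℕ.+ b)} (P.*-congʳ {a} (pdoSeries-α↦αq² b)) ⟩
  (D (2 ℕ.+ b) *ₚ a) +ₚ oddMonomial (2 ℕ.+ b) ∎
  where
  open import Relation.Binary.Reasoning.Setoid P.setoid
  open PSEndomorphism (α↦αq^-isPSEndomorphism 2)
  σ : PS → PS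
  σ = α↦αq^ 2
  D : ℕ → PS
  D = pdoSeries
  a : PS
  a = onePlusαq^ (2 ℕ.+ b)
  regroup : ∀ x a c q p → ((x *ₚ a) +ₚ c) +ₚ (q *ₚ (p *ₚ a)) ≈ₚ ((x +ₚ (q *ₚ p)) *ₚ a) +ₚ c
  regroup = solve 5 (λ x a c q p → (x :* a :+ c) :+ q :* (p :* a) := (x :+ q :* p) :* a :+ c) P.refl

pdoSeries-stable : ∀ b {n} j → n < b → pdoSeries (suc b) n j ≡ pdoSeries b n j
pdoSeries-stable b {n} j n<b =
  ≡.trans (cong (_+_ ((pdoSeries b *ₚ onePlusαq^ b) n j)) (oddMonomial-below b n<b))
  (≡.trans (ℤₚ.+-identityʳ _) (*ₚ-onePlusαq^-below (pdoSeries b) b j n<b))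
  where
  oddMonomial-below : ∀ b → n < b → oddMonomial b n j ≡ + 0
  oddMonomial-below b n<b with odd? b
  ... | yes _ = ≡.trans (cong (λ d → + 1 * (d * δ j 1)) (δ-other (ℕₚ.<⇒≢ n<b))) (ℤₚ.*-zeroˡ (δ j 1))
  ... | no  _ = ≡.refl

-- Comparing coefficients

α↦αq^-invariant⇒α-free : ∀ c {N f} → α↦αq^ (suc c) f ≈⟨ N ⟩ₚ f →
  ∀ n {j} → n ≤ N → f n (suc j) ≡ + 0
α↦αq^-invariant⇒α-free c {N} {f} invariant = <-rec _ vanish
  where
  Vanishes : ℕ → Set
  Vanishes n = ∀ {j} → n ≤ N → f n (suc j) ≡ + 0
  vanish : ∀ n → (∀ {m} → m < n → Vanishes m) → Vanishes n
  vanish n below {j} n≤N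
    with suc c ℕ.* suc j ≤ᵇ n | ℕₚ.≤ᵇ-reflects-≤ (suc c ℕ.* suc j) n | invariant n n≤N (suc j)
  ... | false | _        | f≡0 = ≡.sym f≡0
  ... | true  | ofʸ k≤n | f≡f = ≡.trans (≡.sym f≡f)
    (below (ℕₚ.∸-monoʳ-< (s≤s z≤n) k≤n) (ℕₚ.≤-trans (ℕₚ.m∸n≤m n (suc c ℕ.* suc j)) n≤N))

sumFrom-coeff-cong : ∀ {n j F G} a K → (∀ i → F i n j ≡ G i n j) → sumFrom a K F n j ≡ sumFrom a K G n j
sumFrom-coeff-cong a zero F≡G with a ≤ᵇ 0
... | true  = F≡G 0
... | false = ≡.refl
sumFrom-coeff-cong a (suc K) F≡G with a ≤ᵇ suc K
... | true  = cong₂ _+_ (sumFrom-coeff-cong a K F≡G) (F≡G (suc K))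
... | false = ≡.refl

sumFrom-coeff-zero : ∀ {n j F} a K → (∀ i → F i n j ≡ + 0) → sumFrom a K F n j ≡ + 0
sumFrom-coeff-zero a zero F≡0 with a ≤ᵇ 0
... | true  = F≡0 0
... | false = ≡.refl
sumFrom-coeff-zero a (suc K) F≡0 with a ≤ᵇ suc K
... | true  = cong₂ _+_ (sumFrom-coeff-zero a K F≡0) (F≡0 (suc K))
... | false = ≡.refl

α⁰ : PS → ℤ⟦x⟧.Series
α⁰ f n = f n 0

α⁰-*ₚ : ∀ f g → α⁰ (f *ₚ g) ℤ⟦x⟧.≋ α⁰ f ℤ⟦x⟧.⊛ α⁰ g
α⁰-*ₚ f g n = Σ≤≡sumUpTo n _

α⁰-1ₚ : α⁰ 1ₚ ℤ⟦x⟧.≋ ℤ⟦x⟧.𝟙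
α⁰-1ₚ zero    = ≡.refl
α⁰-1ₚ (suc n) = ≡.refl

α⁰-onePlusαq^ : ∀ t → α⁰ (onePlusαq^ t) ℤ⟦x⟧.≋ ℤ⟦x⟧.𝟙
α⁰-onePlusαq^ t n =
  ≡.trans (cong₂ _+_ (α⁰-1ₚ n) (x*[d*0]≡0 (+ 1) (δ n t))) (ℤₚ.+-identityʳ (ℤ⟦x⟧.𝟙 n))

α⁰-invOnePlusαq^ : ∀ m → α⁰ (invOnePlusαq^ m) ℤ⟦x⟧.≋ ℤ⟦x⟧.𝟙
α⁰-invOnePlusαq^ m n rewrite ℕₚ.*-zeroʳ m = α⁰-1ₚ n

α⁰-prodBelow : ∀ k F → (∀ i → α⁰ (F i) ℤ⟦x⟧.≋ ℤ⟦x⟧.𝟙) → α⁰ (prodBelow k F) ℤ⟦x⟧.≋ ℤ⟦x⟧.𝟙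
α⁰-prodBelow zero    F F≋𝟙 = α⁰-1ₚ
α⁰-prodBelow (suc k) F F≋𝟙 n = ≡.trans (α⁰-*ₚ (prodBelow k F) (F k) n)
  (≡.trans (ℤ⟦x⟧.⊛-cong (α⁰-prodBelow k F F≋𝟙) (F≋𝟙 k) n) (ℤ⟦x⟧.⊛-identityˡ ℤ⟦x⟧.𝟙 n))

α⁰-pochQuotient : ∀ B n → α⁰ (pochQuotient B n) ℤ⟦x⟧.≋ ℤ⟦x⟧.𝟙
α⁰-pochQuotient B n m = ≡.trans (α⁰-*ₚ (negαPoch B) (invNegαqPoch n) m)
  (≡.trans (ℤ⟦x⟧.⊛-cong (α⁰-prodBelow B onePlusαq^ α⁰-onePlusαq^)
                        (α⁰-prodBelow n _ (λ i → α⁰-invOnePlusαq^ (1 ℕ.+ 2 ℕ.* i))) m)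
           (ℤ⟦x⟧.⊛-identityˡ ℤ⟦x⟧.𝟙 m))

α⁰-lhsApprox : ∀ B K n → lhsApprox B K n 0 ≡ sumFrom 1 K sqTerm n 0
α⁰-lhsApprox B K n = sumFrom-coeff-cong 1 K (λ k →
  ≡.trans (α⁰-*ₚ (sqTerm k) (pochQuotient B k) n)
  (≡.trans (ℤ⟦x⟧.⊛-cong {α⁰ (sqTerm k)} {α⁰ (sqTerm k)} (λ _ → ≡.refl) (α⁰-pochQuotient B k) n)
           (ℤ⟦x⟧.⊛-identityʳ (α⁰ (sqTerm k)) n)))

α⁰-pdoSeries : ∀ b → α⁰ (pdoSeries b) ℤ⟦x⟧.≋ ℤ⟦x⟧.𝟘
α⁰-pdoSeries zero    n = ≡.refl
α⁰-pdoSeries (suc b) n = cong₂ _+_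
  (≡.trans (α⁰-*ₚ (pdoSeries b) (onePlusαq^ b) n)
  (≡.trans (ℤ⟦x⟧.⊛-cong {g = α⁰ (onePlusαq^ b)} {g′ = α⁰ (onePlusαq^ b)}
                        (α⁰-pdoSeries b) (λ _ → ≡.refl) n)
           (ℤΣ.sumUpTo-zero n _ (λ _ _ → ≡.refl))))
  (oddMonomial-α⁰ b)
  where
  oddMonomial-α⁰ : ∀ b → oddMonomial b n 0 ≡ + 0
  oddMonomial-α⁰ b with odd? b
  ... | yes _ = x*[d*0]≡0 (+ 1) (δ n b)
  ... | no  _ = ≡.refl

ψ≤ : ℕ → PS
ψ≤ K = sumFrom 1 K (λ n → mono (+ 1) (n ℕ.* n) 0 *ₚ prodBelow n (λ i → invOneMinusαq^ (2 ℕ.* i)))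

substNegαq-ψ≤ : ∀ K → substNegαq (ψ≤ K) ≈ₚ sumFrom 1 K (λ n → sqTerm n *ₚ invNegαqPoch n)
substNegαq-ψ≤ K = P.trans (φ-sumFrom 1 K _) (sumFrom-cong 1 K (λ n → P.trans
  (*-homo (mono (+ 1) (n ℕ.* n) 0) (prodBelow n (λ i → invOneMinusαq^ (2 ℕ.* i))))
  (P.*-cong (substNegαq-q^[n*n] n) (P.trans (φ-prodBelow n _) (prodBelow-cong n substNegαq-invOneMinusαq^)))))
  where open PSEndomorphism substNegαq-isPSEndomorphism

-- Modulo q^(N+1) the truncations at b = N + 1 and B = N + 3 already agree with the infinite sums
-- and products they approximate.
module Truncated (N : ℕ) where

  private
    module P≤ = CommutativeRing (psRing≤ N)
    b : ℕ
    b = suc N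
    B : ℕ
    B = 2 ℕ.+ b
    αqP : PS
    αqP = αq *ₚ negαq²Poch b

  F : PS
  F = lhsApprox B N

  D : PS
  D = pdoSeries b

  F-α↦αq² : α↦αq^ 2 F ≈⟨ N ⟩ₚ F +ₚ αqP
  F-α↦αq² = telescoping-identity (psRing≤ N)
    {a = α} {i = invOnePlusαq^ 0} {G = F}
    {U = sumFrom 1 N (λ k → sqTerm k *ₚ pochQuotient B (1 ℕ.+ k))} {V = sumFrom 1 N (lhsTerm B ∘ suc)}
    {Y = lhsTerm B 1} {s = α↦αq^ 2 F} {p = negαq²Poch b} {q = αq}
    (λ n _ → onePlusαq^-inverse 0 n)
    (λ n _ → lhsApprox-telescope B N n)
    (P≤.trans (λ n _ → α↦αq²-lhsApprox B N n) (sumFrom-cong≤ N 1 N (λ k → P≤.*-congˡ {sqTerm k}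
       (P≤.sym (pochQuotient-stable (1 ℕ.+ k) (ℕₚ.m≤n+m b 2) (ℕₚ.m≤n+m B 2))))))
    (P≤.trans (λ n n≤N j → ≡.sym (sumFrom-stable (λ k → q^[k*k]-*ₚ-below (-1ℤ ^ k) k (pochQuotient B k))
                                                   j n≤N (ℕₚ.n≤1+n N)))
              (λ n _ → sumFrom-1-suc N (lhsTerm B) n))
    (λ n _ → α*lhsTerm1 b n)

  D-α↦αq² : α↦αq^ 2 D +ₚ αqP ≈⟨ N ⟩ₚ D
  D-α↦αq² n n≤N j = ≡.trans (pdoSeries-α↦αq² b n j) (≡.trans
    (pdoSeries-stable (suc b) j (ℕₚ.≤-trans (s≤s n≤N) (ℕₚ.n≤1+n b))) (pdoSeries-stable b j (s≤s n≤N)))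

  F+D-α↦αq² : α↦αq^ 2 (F +ₚ D) ≈⟨ N ⟩ₚ F +ₚ D
  F+D-α↦αq² = begin
    α↦αq^ 2 (F +ₚ D)              ≈⟨ (λ n _ → α↦αq^-+ₚ 2 F D n) ⟩
    α↦αq^ 2 F +ₚ α↦αq^ 2 D        ≈⟨ P≤.+-congʳ {α↦αq^ 2 D} F-α↦αq² ⟩
    (F +ₚ αqP) +ₚ α↦αq^ 2 D       ≈⟨ P≤.+-assoc F αqP (α↦αq^ 2 D) ⟩
    F +ₚ (αqP +ₚ α↦αq^ 2 D)       ≈⟨ P≤.+-congˡ {F} (P≤.+-comm αqP (α↦αq^ 2 D)) ⟩
    F +ₚ (α↦αq^ 2 D +ₚ αqP)       ≈⟨ P≤.+-congˡ {F} D-α↦αq² ⟩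
    F +ₚ D                        ∎
    where open import Relation.Binary.Reasoning.Setoid P≤.setoid

  F+D≡sqSeries : ∀ j → (F +ₚ D) N j ≡ sqSeries N j
  F+D≡sqSeries zero =
    ≡.trans (cong₂ _+_ (α⁰-lhsApprox B N N) (α⁰-pdoSeries b N)) (ℤₚ.+-identityʳ _)
  F+D≡sqSeries (suc j) =
    ≡.trans (α↦αq^-invariant⇒α-free 1 F+D-α↦αq² N ℕₚ.≤-refl)
            (≡.sym (sumFrom-coeff-zero 1 N (λ k → x*[d*0]≡0 (-1ℤ ^ k) (δ N (k ℕ.* k)))))

  lhs≈F : negαPoch∞ *ₚ substNegαq ψ ≈⟨ N ⟩ₚ F
  lhs≈F = begin
    negαPoch∞ *ₚ substNegαq ψ
      ≈⟨ P≤.*-cong negαPoch∞≈ substNegαqψ≈ ⟩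
    negαPoch B *ₚ substNegαq (ψ≤ N)
      ≈⟨ (λ n _ → P.*-congˡ {negαPoch B} (substNegαq-ψ≤ N) n) ⟩
    negαPoch B *ₚ sumFrom 1 N (λ n → sqTerm n *ₚ invNegαqPoch n)
      ≈⟨ (λ n _ → P.trans (sumFrom-*ₚˡ (negαPoch B) 1 N _)
                          (sumFrom-cong 1 N (λ k → swap (negαPoch B) (sqTerm k) (invNegαqPoch k))) n) ⟩
    F ∎
    where
    open import Relation.Binary.Reasoning.Setoid P≤.setoid
    swap : ∀ h t j → h *ₚ (t *ₚ j) ≈ₚ t *ₚ (h *ₚ j)
    swap = solve 3 (λ h t j → h :* (t :* j) := t :* (h :* j)) P.refl
    negαPoch∞≈ : negαPoch∞ ≈⟨ N ⟩ₚ negαPoch B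
    negαPoch∞≈ n n≤N j =
      ≡.sym (negαPoch-stable j ℕₚ.≤-refl (ℕₚ.≤-trans (s≤s n≤N) (ℕₚ.m≤n+m (suc N) 2)))
    substNegαqψ≈ : substNegαq ψ ≈⟨ N ⟩ₚ substNegαq (ψ≤ N)
    substNegαqψ≈ M M≤N j with j ≤ᵇ M
    ... | true  = cong ((-1ℤ ^ M) *_) (≡.sym (sumFrom-stable
      (λ k → q^[k*k]-*ₚ-below (+ 1) k (prodBelow k (λ i → invOneMinusαq^ (2 ℕ.* i))))
      j ℕₚ.≤-refl (ℕₚ.≤-trans (ℕₚ.m∸n≤m M j) M≤N)))
    ... | false = ≡.refl

-- Enumerating P_do

IsPdo-[]⁻ : ¬ IsPdo []
IsPdo-[]⁻ (_ , _ , _ , () , _)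

IsPdo-singleton : ∀ {x} → Odd x → IsPdo [ x ]
IsPdo-singleton {x} odd@(_ , ≡.refl) = [-] , s≤s z≤n ∷ [] , x , here ≡.refl , odd , ℕₚ.≤-refl ∷ []

IsPdo-singleton⁻ : ∀ {x} → IsPdo [ x ] → Odd x
IsPdo-singleton⁻ (_ , _ , s , here ≡.refl , odd , _) = odd

IsPdo-∷ : ∀ {x μ} → IsPdo μ → All (_< x) μ → IsPdo (x ∷ μ)
IsPdo-∷ {x} {y ∷ μ} (linked , positive , s , s∈ , odd , s≤) (y<x ∷ μ<x) =
  y<x ∷ linked , ℕₚ.<-≤-trans (s≤s z≤n) y<x ∷ positive ,
  s , there s∈ , odd , ℕₚ.<⇒≤ (All.lookup (y<x ∷ μ<x) s∈) ∷ s≤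

Linked⇒All< : ∀ {x μ} → Linked _>_ (x ∷ μ) → All (_< x) μ
Linked⇒All< [-]              = []
Linked⇒All< (y<x ∷ linked) = y<x ∷ All.map (λ z<y → ℕₚ.<-trans z<y y<x) (Linked⇒All< linked)

IsPdo-∷⁻ : ∀ {x y μ} → IsPdo (x ∷ y ∷ μ) → IsPdo (y ∷ μ) × All (_< x) (y ∷ μ)
IsPdo-∷⁻ (linked@(_ ∷ linked′) , _ ∷ positive , s , s∈ , odd , _ ∷ s≤) with s∈
... | there s∈′   = (linked′ , positive , s , s∈′ , odd , s≤) , Linked⇒All< linked
... | here ≡.refl = ⊥-elim (ℕₚ.<⇒≱ (All.head (Linked⇒All< linked)) (All.head s≤))

BoundedPdo : ℕ → ℕ → ℕ → List ℕ → Set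
BoundedPdo b n k ν = IsPdo ν × All (_< b) ν × sum ν ≡ n × length ν ≡ k

oddSingleton : ℕ → ℕ → ℕ → List (List ℕ)
oddSingleton b n k with odd? b
... | yes _ = if n ≡ᵇ b then (if k ≡ᵇ 1 then [ [ b ] ] else []) else []
... | no  _ = []

mutual
  pdoList : ℕ → ℕ → ℕ → List (List ℕ)
  pdoList zero    n k = []
  pdoList (suc b) n k = pdoList b n k ++ (prepend b n k ++ oddSingleton b n k)

  prepend : ℕ → ℕ → ℕ → List (List ℕ)
  prepend b n zero    = []
  prepend b n (suc k) = if b ≤ᵇ n then map (b ∷_) (pdoList b (n ∸ b) k) else []

∈-oddSingleton⁻ : ∀ {b n k ν} → ν ∈ oddSingleton b n k → ν ≡ [ b ] × Odd b × n ≡ b × k ≡ 1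
∈-oddSingleton⁻ {b} {n} {k} ν∈ with odd? b
... | no _ with () ← ν∈
... | yes odd with n ≡ᵇ b | ≡ᵇ-reflects-≡ n b | k ≡ᵇ 1 | ≡ᵇ-reflects-≡ k 1 | ν∈
...   | true  | ofʸ n≡b | true  | ofʸ k≡1 | here ν≡[b] = ν≡[b] , odd , n≡b , k≡1
...   | true  | _       | false | _       | ()
...   | false | _       | _     | _       | ()

∈-oddSingleton⁺ : ∀ {b} → Odd b → [ b ] ∈ oddSingleton b b 1
∈-oddSingleton⁺ {b} odd with odd? b
... | no ¬odd = ⊥-elim (¬odd odd)
... | yes _ with b ≡ᵇ b | ≡ᵇ-reflects-≡ b b
...   | true  | _        = here ≡.refl
...   | false | ofⁿ b≢b = ⊥-elim (b≢b ≡.refl)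

∈-prepend⁻ : ∀ {b n k ν} → ν ∈ prepend b n k →
  ∃ λ μ → μ ∈ pdoList b (n ∸ b) (k ∸ 1) × ν ≡ b ∷ μ × b ≤ n × 1 ≤ k
∈-prepend⁻ {b} {n} {suc k} ν∈ with b ≤ᵇ n | ℕₚ.≤ᵇ-reflects-≤ b n
... | true  | ofʸ b≤n = let μ , μ∈ , ν≡ = ∈-map⁻ (b ∷_) ν∈ in μ , μ∈ , ν≡ , b≤n , s≤s z≤n
... | false | _ with () ← ν∈

∈-prepend⁺ : ∀ {b n k μ} → b ≤ n → μ ∈ pdoList b (n ∸ b) k → (b ∷ μ) ∈ prepend b n (suc k)
∈-prepend⁺ {b} {n} b≤n μ∈ with b ≤ᵇ n | ℕₚ.≤ᵇ-reflects-≤ b n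
... | true  | _        = ∈-map⁺ (b ∷_) μ∈
... | false | ofⁿ b≰n = ⊥-elim (b≰n b≤n)

pdoList-sound : ∀ b {n k ν} → ν ∈ pdoList b n k → BoundedPdo b n k ν
pdoList-sound (suc b) {n} {k} ν∈ with ∈-++⁻ (pdoList b n k) ν∈
... | inj₁ ν∈pdo = let pdo , ν<b , sum≡ , length≡ = pdoList-sound b ν∈pdo in
  pdo , All.map ℕₚ.m≤n⇒m≤1+n ν<b , sum≡ , length≡
... | inj₂ ν∈new with ∈-++⁻ (prepend b n k) ν∈new
...   | inj₁ ν∈prepend with ∈-prepend⁻ {b} {n} {k} ν∈prepend
...     | μ , μ∈ , ≡.refl , b≤n , 1≤k = let pdo , μ<b , sum≡ , length≡ = pdoList-sound b μ∈ in
  IsPdo-∷ pdo μ<b , ℕₚ.≤-refl ∷ All.map ℕₚ.m≤n⇒m≤1+n μ<b ,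
  ≡.trans (cong (b ℕ.+_) sum≡) (ℕₚ.m+[n∸m]≡n b≤n) , ≡.trans (cong suc length≡) (ℕₚ.m+[n∸m]≡n 1≤k)
pdoList-sound (suc b) {n} {k} ν∈ | inj₂ ν∈new | inj₂ ν∈odd with ∈-oddSingleton⁻ {b} {n} {k} ν∈odd
...     | ≡.refl , odd , ≡.refl , ≡.refl = IsPdo-singleton odd , ℕₚ.≤-refl ∷ [] , ℕₚ.+-identityʳ b , ≡.refl

pdoList-complete : ∀ b {n k ν} → BoundedPdo b n k ν → ν ∈ pdoList b n k
pdoList-complete b       {ν = []}    (pdo , _) = ⊥-elim (IsPdo-[]⁻ pdo)
pdoList-complete zero    {ν = x ∷ μ} (_ , () ∷ _ , _)
pdoList-complete (suc b) {n} {k} {x ∷ μ} (pdo , x<1+b ∷ _ , sum≡ , length≡)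
  with ℕₚ.m≤n⇒m<n∨m≡n (ℕₚ.m<1+n⇒m≤n x<1+b)
... | inj₁ x<b = ∈-++⁺ˡ (pdoList-complete b
      (pdo , x<b ∷ All.map (λ y<x → ℕₚ.<-trans y<x x<b) (Linked⇒All< (proj₁ pdo)) , sum≡ , length≡))
pdoList-complete (suc b) {.(b ℕ.+ 0)} {.1} {b ∷ []} (pdo , _ , ≡.refl , ≡.refl) | inj₂ ≡.refl =
  ∈-++⁺ʳ (pdoList b (b ℕ.+ 0) 1) (∈-++⁺ʳ (prepend b (b ℕ.+ 0) 1)
    (≡.subst (λ m → [ b ] ∈ oddSingleton b m 1) (≡.sym (ℕₚ.+-identityʳ b))
             (∈-oddSingleton⁺ (IsPdo-singleton⁻ pdo))))
pdoList-complete (suc b) {.(b ℕ.+ sum (y ∷ μ))} {.(suc (length (y ∷ μ)))} {b ∷ y ∷ μ} (pdo , _ , ≡.refl , ≡.refl)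
  | inj₂ ≡.refl = let pdo′ , yμ<b = IsPdo-∷⁻ pdo in
  ∈-++⁺ʳ (pdoList b _ _) (∈-++⁺ˡ (∈-prepend⁺ (ℕₚ.m≤m+n b (sum (y ∷ μ)))
    (pdoList-complete b (pdo′ , yμ<b , ≡.sym (ℕₚ.m+n∸m≡n b (sum (y ∷ μ))) , ≡.refl))))

∈-prepend++oddSingleton⁻ : ∀ {b n k ν} → ν ∈ prepend b n k ++ oddSingleton b n k → ∃ λ μ → ν ≡ b ∷ μ
∈-prepend++oddSingleton⁻ {b} {n} {k} ν∈ with ∈-++⁻ (prepend b n k) ν∈
... | inj₁ ν∈prepend = let μ , _ , ν≡ , _ = ∈-prepend⁻ {b} {n} {k} ν∈prepend in μ , ν≡
... | inj₂ ν∈odd     = [] , proj₁ (∈-oddSingleton⁻ {b} {n} {k} ν∈odd)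

pdoList-unique : ∀ b n k → Unique (pdoList b n k)
pdoList-unique zero    n k = []
pdoList-unique (suc b) n k = Uniqueₚ.++⁺ (pdoList-unique b n k)
  (Uniqueₚ.++⁺ (prepend-unique k) oddSingleton-unique prepend-oddSingleton-disjoint) old-new-disjoint
  where
  prepend-unique : ∀ k → Unique (prepend b n k)
  prepend-unique zero    = []
  prepend-unique (suc k) with b ≤ᵇ n
  ... | true  = Uniqueₚ.map⁺ Listₚ.∷-injectiveʳ (pdoList-unique b (n ∸ b) k)
  ... | false = []
  oddSingleton-unique : Unique (oddSingleton b n k)
  oddSingleton-unique with odd? b
  ... | no  _ = []
  ... | yes _ with n ≡ᵇ b | k ≡ᵇ 1
  ...   | true  | true  = [] ∷ []
  ...   | true  | false = []
  ...   | false | _     = []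
  prepend-oddSingleton-disjoint : ∀ {ν} → ¬ (ν ∈ prepend b n k × ν ∈ oddSingleton b n k)
  prepend-oddSingleton-disjoint (ν∈prepend , ν∈odd)
    with ∈-prepend⁻ {b} {n} {k} ν∈prepend | ∈-oddSingleton⁻ {b} {n} {k} ν∈odd
  ... | μ , μ∈ , ≡.refl , _ | [b]≡b∷μ , _ with ≡.refl ← Listₚ.∷-injectiveʳ [b]≡b∷μ =
    IsPdo-[]⁻ (proj₁ (pdoList-sound b μ∈))
  old-new-disjoint : ∀ {ν} → ¬ (ν ∈ pdoList b n k × ν ∈ prepend b n k ++ oddSingleton b n k)
  old-new-disjoint (ν∈old , ν∈new) with ∈-prepend++oddSingleton⁻ {b} {n} {k} ν∈new
  ... | μ , ≡.refl with pdoList-sound b ν∈old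
  ... | _ , b<b ∷ _ , _ = ℕₚ.<-irrefl ≡.refl b<b

pdoSeries≡length-pdoList : ∀ b n k → pdoSeries b n k ≡ + length (pdoList b n k)
pdoSeries≡length-pdoList zero    n k = ≡.refl
pdoSeries≡length-pdoList (suc b) n k = begin
  (pdoSeries b *ₚ onePlusαq^ b) n k + oddMonomial b n k
    ≡⟨ cong (_+ oddMonomial b n k) (*ₚ-onePlusαq^ (pdoSeries b) b n k) ⟩
  (pdoSeries b n k + (mono (+ 1) b 1 *ₚ pdoSeries b) n k) + oddMonomial b n k
    ≡⟨ cong₂ _+_ (cong₂ _+_ (pdoSeries≡length-pdoList b n k)
                            (≡.trans (mono-*ₚ (+ 1) b 1 (pdoSeries b) n k) (prepend-count k)))
                 oddSingleton-count ⟩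
  (+ length (pdoList b n k) + + length (prepend b n k)) + + length (oddSingleton b n k)
    ≡⟨ ℤₚ.+-assoc (+ length (pdoList b n k)) (+ length (prepend b n k)) (+ length (oddSingleton b n k)) ⟩
  + (length (pdoList b n k) ℕ.+ (length (prepend b n k) ℕ.+ length (oddSingleton b n k)))
    ≡⟨ cong +_ (≡.sym (≡.trans (Listₚ.length-++ (pdoList b n k))
                 (cong (length (pdoList b n k) ℕ.+_) (Listₚ.length-++ (prepend b n k))))) ⟩
  + length (pdoList (suc b) n k) ∎
  where
  open ≡.≡-Reasoning
  prepend-count : ∀ k →
    (if b ≤ᵇ n then (if 1 ≤ᵇ k then + 1 * pdoSeries b (n ∸ b) (k ∸ 1) else + 0) else + 0) ≡ + length (prepend b n k)
  prepend-count zero with b ≤ᵇ n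
  ... | true  = ≡.refl
  ... | false = ≡.refl
  prepend-count (suc k) with b ≤ᵇ n
  ... | true  = ≡.trans (ℤₚ.*-identityˡ _) (≡.trans (pdoSeries≡length-pdoList b (n ∸ b) k)
                  (cong +_ (≡.sym (Listₚ.length-map (b ∷_) (pdoList b (n ∸ b) k)))))
  ... | false = ≡.refl
  oddSingleton-count : oddMonomial b n k ≡ + length (oddSingleton b n k)
  oddSingleton-count with odd? b
  ... | no  _ = ≡.refl
  ... | yes _ with n ≡ᵇ b | k ≡ᵇ 1
  ...   | true  | true  = ≡.refl
  ...   | true  | false = ≡.refl
  ...   | false | true  = ≡.refl
  ...   | false | false = ≡.refl

∈⇒≤sum : ∀ {x ν} → x ∈ ν → x ≤ sum ν
∈⇒≤sum {ν = y ∷ ν} (here ≡.refl) = ℕₚ.m≤m+n y (sum ν)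
∈⇒≤sum {ν = y ∷ ν} (there x∈ν)  = ℕₚ.≤-trans (∈⇒≤sum x∈ν) (ℕₚ.m≤n+m (sum ν) y)

theorem5p4 : (N j : ℕ) →
    Σ[ L ∈ List (List ℕ) ]
      ( Unique L
      × ((ν : List ℕ) → (ν ∈ L) ⇔ (IsPdo ν × sum ν ≡ N × length ν ≡ j))
      × ((negαPoch∞ *ₚ substNegαq ψ) N j ≡ - (+ length L) + sqSeries N j) )
theorem5p4 N j = pdoList (suc N) N j , pdoList-unique (suc N) N j , characterisation , identity
  where
  characterisation : (ν : List ℕ) → (ν ∈ pdoList (suc N) N j) ⇔ (IsPdo ν × sum ν ≡ N × length ν ≡ j)
  characterisation ν = mk⇔
    (λ ν∈ → let pdo , _ , sum≡ , length≡ = pdoList-sound (suc N) ν∈ in pdo , sum≡ , length≡)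
    (λ (pdo , sum≡ , length≡) → pdoList-complete (suc N)
      (pdo , All.tabulate (λ x∈ν → s≤s (≡.subst (_ ≤_) sum≡ (∈⇒≤sum x∈ν))) , sum≡ , length≡))
  identity : (negαPoch∞ *ₚ substNegαq ψ) N j ≡ - (+ length (pdoList (suc N) N j)) + sqSeries N j
  identity = begin
    (negαPoch∞ *ₚ substNegαq ψ) N j    ≡⟨ lhs≈F N ℕₚ.≤-refl j ⟩
    F N j                              ≡⟨ isolate (F N j) (D N j) ⟩
    - D N j + (F +ₚ D) N j             ≡⟨ cong (_+_ (- D N j)) (F+D≡sqSeries j) ⟩
    - D N j + sqSeries N j             ≡⟨ cong (λ d → - d + sqSeries N j) (pdoSeries≡length-pdoList (suc N) N j) ⟩
    - (+ length (pdoList (suc N) N j)) + sqSeries N j ∎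
    where
    open ≡.≡-Reasoning
    open Truncated N using (F; D; F+D≡sqSeries; lhs≈F)
    isolate : ∀ f d → f ≡ - d + (f + d)
    isolate = ℤ-Solver.solve-∀
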